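{- Let $m\ge 1$, $q=2^m$, $K=GF(q)$, let $i,t,s$ be positive integers with $i\mid t$, and let $\delta\in K$ be nonzero. Let $D=2^{t+s}+2^s-2^i-1$ and let $$H_D(x,y)=\delta (xy)^{2^s-1}\,\frac{\left(x^{2^t-1}+y^{2^t-1}\right)^{2^s}}{x^{2^i-1}+y^{2^i-1}},$$ a homogeneous polynomial of degree $D$, and consider the projective plane curve $H(x,y,z)=z^{D}+H_D(x,y)=0$ over $\overline{K}$. Then the points of this curve in $\mathbb{P}^2(\overline{K})$ and their multiplicities are as follows: every point $[a:b:1]$ with $H(a,b,1)=0$ has multiplicity $1$; the points $[1:b:0]$ with $b\in GF(2^i)$ have multiplicity $2^s-1$; the points $[1:b:0]$ with $b\in GF(2^t)\setminus GF(2^i)$ have multiplicity $2^s$; and the point $[0:1:0]$ has multiplicity $2^s-1$.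
   Context: When $i\mid t$, the polynomial $1+H_D(x,y)$ equals $F(x,y)/(x^{2^i-1}+y^{2^i-1})$, where $F(x,y)=x^{2^i-1}+y^{2^i-1}+\delta(xy)^{2^s-1}(x^{2^t-1}+y^{2^t-1})^{2^s}$, and $H(x,y,z)$ is its homogenization. Multiplicity of a point on a curve means the order of vanishing (lowest degree of a nonzero homogeneous term in the local expansion) of the defining polynomial at that point; a point has positive multiplicity iff it lies on the curve. -}

module Defs where

open import Level using (Level; _⊔_)
open import Algebra.Bundles using (CommutativeRing)
import Data.Nat
open import Data.Nat using (ℕ; zero; suc; _∸_; _≡ᵇ_) renaming (_+_ to _+ℕ_; _<_ to _<ℕ_)
open import Data.Nat.Combinatorics using (_C_)
open import Data.Bool using (if_then_else_; _∧_)
open import Data.List using (List; []; _∷_; _++_; map; concatMap; length)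
open import Data.Product using (_×_; _,_; ∃; ∃-syntax)
open import Relation.Binary.PropositionalEquality using (_≡_)
open import Relation.Nullary using (¬_)

module Over {c ℓ : Level} (R : CommutativeRing c ℓ) where
  open CommutativeRing R hiding (Carrier; _≈_; 0#; 1#)
  open CommutativeRing R public using (_≈_; 0#; 1#) renaming (Carrier to F)

  infixr 8 _**_
  _**_ : F → ℕ → F
  x ** zero = 1#
  x ** suc n = x * (x ** n)

  _·_ : ℕ → F → F
  zero · x = 0#
  suc n · x = x + (n · x)

  IsField : Set (c ⊔ ℓ)
  IsField = (¬ (1# ≈ 0#)) × (∀ x → ¬ (x ≈ 0#) → ∃[ y ] (x * y ≈ 1#))

  CharacteristicTwo : Set ℓ
  CharacteristicTwo = 1# + 1# ≈ 0#

  evalU : List F → F → F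
  evalU [] x = 0#
  evalU (a ∷ as) x = a + x * evalU as x

  -- every monic polynomial  x^(n+1) + c_n x^n + … + c₀  of degree ≥ 1 has a root
  AlgebraicallyClosed : Set (c ⊔ ℓ)
  AlgebraicallyClosed = ∀ (cs : List F) → ∃[ x ] (x ** suc (length cs) + evalU cs x ≈ 0#)

  -- in characteristic 2: every element lies in some finite field GF(2^(n+1)),
  -- i.e. R is algebraic over its prime field GF(2)
  AlgebraicOverGF2 : Set (c ⊔ ℓ)
  AlgebraicOverGF2 = ∀ x → ∃[ n ] (x ** (2 Data.Nat.^ suc n) ≈ x)

  InGF2^ : ℕ → F → Set ℓ
  InGF2^ k x = x ** (2 Data.Nat.^ k) ≈ x

  -- Polynomials in three variables x, y, z: finite lists of monomials
  -- (coefficient, exponent of x, exponent of y, exponent of z).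

  Monomial : Set c
  Monomial = F × ℕ × ℕ × ℕ

  Poly3 : Set c
  Poly3 = List Monomial

  coeff : Poly3 → ℕ → ℕ → ℕ → F
  coeff [] a b d = 0#
  coeff ((k , e , f , g) ∷ p) a b d =
    (if (e ≡ᵇ a) ∧ (f ≡ᵇ b) ∧ (g ≡ᵇ d) then k else 0#) + coeff p a b d

  _≈P_ : Poly3 → Poly3 → Set ℓ
  P ≈P Q = ∀ a b d → coeff P a b d ≈ coeff Q a b d

  infix 4 _≈P_
  infixl 6 _+P_
  infixl 7 _*P_
  infixr 8 _^P_

  _+P_ : Poly3 → Poly3 → Poly3
  P +P Q = P ++ Q

  mulMono : Monomial → Monomial → Monomial
  mulMono (k , e , f , g) (k' , e' , f' , g') = (k * k' , e +ℕ e' , f +ℕ f' , g +ℕ g')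

  _*P_ : Poly3 → Poly3 → Poly3
  P *P Q = concatMap (λ m → map (mulMono m) Q) P

  const : F → Poly3
  const k = (k , 0 , 0 , 0) ∷ []

  X Y Z : Poly3
  X = (1# , 1 , 0 , 0) ∷ []
  Y = (1# , 0 , 1 , 0) ∷ []
  Z = (1# , 0 , 0 , 1) ∷ []

  _^P_ : Poly3 → ℕ → Poly3
  P ^P zero = const 1#
  P ^P suc n = P *P (P ^P n)

  eval : Poly3 → F → F → F → F
  eval [] a b d = 0#
  eval ((k , e , f , g) ∷ p) a b d = k * (a ** e) * (b ** f) * (d ** g) + eval p a b d

  -- Local expansion at (a,b,d): P(a+u, b+v, d+w) = Σ localCoeff P a b d j k l · u^j v^k w^l
  -- (binomial expansion; n C k = 0 for k > n).
  localCoeff : Poly3 → F → F → F → ℕ → ℕ → ℕ → F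
  localCoeff [] a b d j k l = 0#
  localCoeff ((κ , e , f , g) ∷ p) a b d j k l =
    ((e C j) · ((f C k) · ((g C l) ·
       (κ * (a ** (e ∸ j)) * (b ** (f ∸ k)) * (d ** (g ∸ l))))))
    + localCoeff p a b d j k l

  -- Multiplicity of a point of the projective curve P = 0, computed in the
  -- affine chart where the indicated coordinate equals 1: the lowest degree of
  -- a nonzero homogeneous term of the local expansion of the dehomogenised
  -- polynomial at the point.

  -- point [a : b : 1], chart z = 1, local coordinates (x, y)
  MultZ : Poly3 → F → F → ℕ → Set ℓ
  MultZ P a b m =
    (∀ j k → j +ℕ k <ℕ m → localCoeff P a b 1# j k 0 ≈ 0#)
    × ∃[ j ] ∃[ k ] ((j +ℕ k ≡ m) × ¬ (localCoeff P a b 1# j k 0 ≈ 0#))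

  -- point [1 : b : d], chart x = 1, local coordinates (y, z)
  MultX : Poly3 → F → F → ℕ → Set ℓ
  MultX P b d m =
    (∀ j k → j +ℕ k <ℕ m → localCoeff P 1# b d 0 j k ≈ 0#)
    × ∃[ j ] ∃[ k ] ((j +ℕ k ≡ m) × ¬ (localCoeff P 1# b d 0 j k ≈ 0#))

  -- point [a : 1 : d], chart y = 1, local coordinates (x, z)
  MultY : Poly3 → F → F → ℕ → Set ℓ
  MultY P a d m =
    (∀ j k → j +ℕ k <ℕ m → localCoeff P a 1# d j 0 k ≈ 0#)
    × ∃[ j ] ∃[ k ] ((j +ℕ k ≡ m) × ¬ (localCoeff P a 1# d j 0 k ≈ 0#))

{-# OPTIONS --safe #-}
-- HD is a binary form of degree D: comparing coefficients in HD (x^r + y^r) = N, where N is a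
-- form of degree D + r, forces every coefficient of HD off degree D to vanish.
-- At an affine point of H = z^D + HD we have HD = 1 (characteristic 2), and Euler's identity for
-- the form HD of odd degree D makes one partial derivative nonzero, so the point is simple.
-- At infinity the term z^D only matters in degree D, so the multiplicity at [1:b:0] (or [0:1:0])
-- is the order of vanishing of HD along the line y ↦ (1, b + y) (or x ↦ (x, 1)). Orders add over
-- products (Leibniz rule), so it is the order of N minus that of x^r + y^r, read off from the
-- factors: y vanishes to order 1 at b = 0, and x^n + y^n vanishes at (1, b) exactly when b^n = 1,
-- to order 1 since n = 2^k - 1 is odd; b^(2^k - 1) = 1 means b ∈ GF(2^k)^×.
module Submission where

open import Defs
open import Level using (Level)
open import Algebra.Bundles using (CommutativeRing)
import Algebra.Solver.CommutativeMonoid as CommutativeMonoidSolver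
open import Tactic.RingSolver.Core.AlmostCommutativeRing using (fromCommutativeRing)
open import Data.Bool using (true; false; if_then_else_; _∧_)
open import Data.Empty using (⊥-elim)
open import Data.List using (List; []; _∷_; _++_; map)
open import Data.List.Properties using (map-++)
open import Data.List.Relation.Unary.All using (All; []; _∷_)
open import Data.Maybe using (nothing)
open import Data.Nat using (ℕ; zero; suc; _∸_; _≡ᵇ_; z≤n; s≤s; >-nonZero)
  renaming (_+_ to _+ℕ_; _*_ to _*ℕ_; _^_ to _^ℕ_; _≤_ to _≤ℕ_; _<_ to _<ℕ_)
open import Data.Nat.Divisibility using (_∣_; divides; ∣⇒≤)
open import Data.Nat.Combinatorics using (_C_; k>n⇒nCk≡0; nCk+nC[k+1]≡[n+1]C[k+1]; nC1≡n; nCn≡1)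
import Data.Nat.Properties as ℕP
open import Data.Nat.Tactic.RingSolver using (solve-∀)
open import Data.Product using (_×_; _,_; proj₁; proj₂; ∃-syntax)
open import Data.Sum using (_⊎_; inj₁; inj₂)
open import Function using (_⟨_⟩_)
open import Relation.Binary.Definitions using (Decidable; tri<; tri≈; tri>)
open import Relation.Binary.PropositionalEquality as P using (_≡_; _≢_)
open import Relation.Nullary using (¬_; yes; no)
open import Relation.Nullary.Decidable using (_×-dec_)

1≤⇒≡suc[∸1] : ∀ {n} → 1 ≤ℕ n → n ≡ suc (n ∸ 1)
1≤⇒≡suc[∸1] (s≤s z≤n) = P.refl

module PowersOfTwo where
  open import Data.Nat using (_+_; _*_; _^_; _≤_)

  2^n≡2*suc : ∀ n → 1 ≤ n → ∃[ a ] 2 ^ n ≡ 2 * suc a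
  2^n≡2*suc (suc n) _ = 2 ^ n ∸ 1 , P.cong (2 *_) (1≤⇒≡suc[∸1] (ℕP.m^n>0 2 n))

  ∸-by-+ : ∀ {x y q} → x ≡ q + y → x ∸ y ≡ q
  ∸-by-+ {y = y} {q} eq = P.trans (P.cong (_∸ y) eq) (ℕP.m+n∸n≡m q y)

  2*suc∸1-odd : ∀ a → 2 * suc a ∸ 1 ≡ suc (a + a)
  2*suc∸1-odd a = ∸-by-+ (lemma a)
    where
    lemma : ∀ a → 2 * suc a ≡ suc (a + a) + 1
    lemma = solve-∀

  2^n∸1-odd : ∀ n → 1 ≤ n → ∃[ k ] 2 ^ n ∸ 1 ≡ suc (k + k)
  2^n∸1-odd n 1≤n with 2^n≡2*suc n 1≤n
  ... | a , eq = a , P.trans (P.cong (_∸ 1) eq) (2*suc∸1-odd a)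

-- Writing 2^s = 2(1+a), 2^i = 2(1+z) and 2^t = 2(1+z+w), all facts below are polynomial identities in a, z, w.
module Exponents (i t s : ℕ) (1≤i : 1 ≤ℕ i) (1≤t : 1 ≤ℕ t) (1≤s : 1 ≤ℕ s) (i∣t : i ∣ t) where
  open import Data.Nat using (_+_; _*_; _^_; _≤_)
  open PowersOfTwo

  private
    a = proj₁ (2^n≡2*suc s 1≤s)
    z = proj₁ (2^n≡2*suc i 1≤i)
    c = proj₁ (2^n≡2*suc t 1≤t)
    z≤c : z ≤ c
    z≤c = ℕP.≤-pred (ℕP.*-cancelˡ-≤ 2 (P.subst₂ _≤_ (proj₂ (2^n≡2*suc i 1≤i)) (proj₂ (2^n≡2*suc t 1≤t))
            (ℕP.^-monoʳ-≤ 2 (∣⇒≤ {{>-nonZero 1≤t}} i∣t))))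
    w = c ∸ z
    2^s≡ : 2 ^ s ≡ 2 * suc a
    2^s≡ = proj₂ (2^n≡2*suc s 1≤s)
    2^i≡ : 2 ^ i ≡ 2 * suc z
    2^i≡ = proj₂ (2^n≡2*suc i 1≤i)
    2^t≡ : 2 ^ t ≡ 2 * suc (z + w)
    2^t≡ = P.trans (proj₂ (2^n≡2*suc t 1≤t)) (P.cong (λ k → 2 * suc k) (P.sym (ℕP.m+[n∸m]≡n z≤c)))
    M : ℕ
    M = 2 * a * w + 3 * a + 2 * w + 1 + 2 * a * z + z

    D-poly : (2 * suc (z + w)) * (2 * suc a) + 2 * suc a ≡ (suc (M + M) + 1) + 2 * suc z
    D-poly = lemma a z w
      where
      lemma : ∀ a z w → (2 * suc (z + w)) * (2 * suc a) + 2 * suc a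
                        ≡ (suc ((2 * a * w + 3 * a + 2 * w + 1 + 2 * a * z + z)
                                + (2 * a * w + 3 * a + 2 * w + 1 + 2 * a * z + z)) + 1) + 2 * suc z
      lemma = solve-∀

  D : ℕ
  D = 2 ^ (t + s) + 2 ^ s ∸ 2 ^ i ∸ 1

  private
    D≡odd : D ≡ suc (M + M)
    D≡odd rewrite ℕP.^-distribˡ-+-* 2 t s | 2^t≡ | 2^s≡ | 2^i≡ = ∸-by-+ (∸-by-+ D-poly)

  D-odd : ∃[ k ] D ≡ suc (k + k)
  D-odd = M , D≡odd

  2^s≤D : 2 ^ s ≤ D
  2^s≤D rewrite D≡odd | 2^s≡ = P.subst (2 * suc a ≤_) (P.sym (lemma a z w)) (ℕP.m≤m+n _ _)
    where
    lemma : ∀ a z w → suc ((2 * a * w + 3 * a + 2 * w + 1 + 2 * a * z + z) + (2 * a * w + 3 * a + 2 * w + 1 + 2 * a * z + z))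
                      ≡ 2 * suc a + (4 * a * w + 4 * a + 4 * w + 4 * a * z + 2 * z + 1)
    lemma = solve-∀

  degree-balance : 2 * (2 ^ s ∸ 1) + 2 ^ s * (2 ^ t ∸ 1) ≡ D + (2 ^ i ∸ 1)
  degree-balance = begin
    2 * (2 ^ s ∸ 1) + 2 ^ s * (2 ^ t ∸ 1)  ≡⟨ P.cong₂ (λ x y → 2 * x + 2 ^ s * y) (odd s 2^s≡) (odd t 2^t≡) ⟩
    2 * suc (a + a) + 2 ^ s * T'           ≡⟨ P.cong (λ x → 2 * suc (a + a) + x * T') 2^s≡ ⟩
    2 * suc (a + a) + 2 * suc a * T'       ≡⟨ lemma a z w ⟩
    suc (M + M) + suc (z + z)              ≡⟨ P.sym (P.cong₂ _+_ D≡odd (odd i 2^i≡)) ⟩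
    D + (2 ^ i ∸ 1)                        ∎
    where
    open P.≡-Reasoning
    T' = suc ((z + w) + (z + w))
    odd : ∀ n {k} → 2 ^ n ≡ 2 * suc k → 2 ^ n ∸ 1 ≡ suc (k + k)
    odd _ {k} eq = P.trans (P.cong (_∸ 1) eq) (2*suc∸1-odd k)
    lemma : ∀ a z w → 2 * suc (a + a) + 2 * suc a * suc ((z + w) + (z + w))
                      ≡ suc ((2 * a * w + 3 * a + 2 * w + 1 + 2 * a * z + z) + (2 * a * w + 3 * a + 2 * w + 1 + 2 * a * z + z)) + suc (z + z)
    lemma = solve-∀

private
  ≡ᵇ-refl : ∀ n → (n ≡ᵇ n) ≡ true
  ≡ᵇ-refl zero = P.refl
  ≡ᵇ-refl (suc n) = ≡ᵇ-refl n

  ≡ᵇ-true⇒≡ : ∀ m n → (m ≡ᵇ n) ≡ true → m ≡ n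
  ≡ᵇ-true⇒≡ zero zero _ = P.refl
  ≡ᵇ-true⇒≡ (suc m) (suc n) p = P.cong suc (≡ᵇ-true⇒≡ m n p)

  +-≤-split : ∀ m {n N} → m +ℕ n ≤ℕ N → m ≤ℕ N × n ≤ℕ N
  +-≤-split m {n} le = ℕP.≤-trans (ℕP.m≤m+n m n) le , ℕP.≤-trans (ℕP.m≤n+m n m) le

InDegree : ℕ → ℕ → ℕ → ℕ → Set
InDegree n e f g = g ≡ 0 × e +ℕ f ≡ n

module _ {c ℓ : Level} (R : CommutativeRing c ℓ) where
  open Over R
  open CommutativeRing R hiding (Carrier; _≈_; 0#; 1#; zero)
    renaming (refl to ≈-refl; sym to ≈-sym; trans to ≈-trans)
  open import Relation.Binary.Reasoning.Setoid setoid
  open import Tactic.RingSolver.NonReflective (fromCommutativeRing R (λ _ → nothing)) using (solve; _⊜_; _⊕_; _⊗_)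
  module CM = CommutativeMonoidSolver *-commutativeMonoid

  ≈0+≈0 : ∀ {x y} → x ≈ 0# → y ≈ 0# → x + y ≈ 0#
  ≈0+≈0 p q = ≈-trans (+-cong p q) (+-identityˡ 0#)

  *-≈0ʳ : ∀ x {y} → y ≈ 0# → x * y ≈ 0#
  *-≈0ʳ x p = ≈-trans (*-congˡ p) (zeroʳ x)

  *-≈0ˡ : ∀ {x} → x ≈ 0# → ∀ y → x * y ≈ 0#
  *-≈0ˡ p y = ≈-trans (*-congʳ p) (zeroˡ y)

  +-≈0ʳ : ∀ x {y} → y ≈ 0# → x + y ≈ x
  +-≈0ʳ x p = ≈-trans (+-congˡ p) (+-identityʳ x)

  +-≈0ˡ : ∀ {x} → x ≈ 0# → ∀ y → x + y ≈ y
  +-≈0ˡ p y = ≈-trans (+-congʳ p) (+-identityˡ y)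

  ≈-by-≡ : ∀ {A : Set} (f : A → F) {a b} → a ≡ b → f a ≈ f b
  ≈-by-≡ f e = reflexive (P.cong f e)

  **-cong : ∀ {x y} n → x ≈ y → x ** n ≈ y ** n
  **-cong zero p = ≈-refl
  **-cong (suc n) p = *-cong p (**-cong n p)

  **-distribˡ-+-* : ∀ x m n → x ** (m +ℕ n) ≈ x ** m * x ** n
  **-distribˡ-+-* x zero n = ≈-sym (*-identityˡ _)
  **-distribˡ-+-* x (suc m) n = ≈-trans (*-congˡ (**-distribˡ-+-* x m n)) (≈-sym (*-assoc _ _ _))

  **-*-assoc : ∀ x m n → (x ** m) ** n ≈ x ** (m *ℕ n)
  **-*-assoc x m zero = ≈-by-≡ (x **_) (P.sym (ℕP.*-zeroʳ m))
  **-*-assoc x m (suc n) = begin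
    x ** m * (x ** m) ** n  ≈⟨ *-congˡ (**-*-assoc x m n) ⟩
    x ** m * x ** (m *ℕ n)  ≈⟨ ≈-sym (**-distribˡ-+-* x m (m *ℕ n)) ⟩
    x ** (m +ℕ m *ℕ n)      ≡⟨ P.cong (x **_) (P.sym (ℕP.*-suc m n)) ⟩
    x ** (m *ℕ suc n)       ∎

  1#**n≈1# : ∀ n → 1# ** n ≈ 1#
  1#**n≈1# zero = ≈-refl
  1#**n≈1# (suc n) = ≈-trans (*-identityˡ _) (1#**n≈1# n)

  0#**suc≈0# : ∀ n → 0# ** suc n ≈ 0#
  0#**suc≈0# n = zeroˡ _

  inGF2^-cong : ∀ n {x y} → x ≈ y → InGF2^ n x → InGF2^ n y
  inGF2^-cong n x≈y x∈ = ≈-trans (**-cong (2 ^ℕ n) (≈-sym x≈y)) (≈-trans x∈ x≈y)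

  inGF2^-0# : ∀ n → InGF2^ n 0#
  inGF2^-0# n = P.subst (λ k → 0# ** k ≈ 0#) (P.sym (1≤⇒≡suc[∸1] (ℕP.m^n>0 2 n))) (0#**suc≈0# (2 ^ℕ n ∸ 1))

  inGF2^-* : ∀ {x} i k → InGF2^ i x → InGF2^ (k *ℕ i) x
  inGF2^-* i zero x∈ = *-identityʳ _
  inGF2^-* {x} i (suc k) x∈ = begin
    x ** (2 ^ℕ (i +ℕ k *ℕ i))
      ≡⟨ P.cong (x **_) (P.trans (ℕP.^-distribˡ-+-* 2 i (k *ℕ i)) (ℕP.*-comm (2 ^ℕ i) _)) ⟩
    x ** (2 ^ℕ (k *ℕ i) *ℕ 2 ^ℕ i)        ≈⟨ ≈-sym (**-*-assoc x (2 ^ℕ (k *ℕ i)) (2 ^ℕ i)) ⟩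
    (x ** (2 ^ℕ (k *ℕ i))) ** (2 ^ℕ i)    ≈⟨ **-cong (2 ^ℕ i) (inGF2^-* i k x∈) ⟩
    x ** (2 ^ℕ i)                         ≈⟨ x∈ ⟩
    x                                     ∎

  inGF2^-∣ : ∀ {x i t} → i ∣ t → InGF2^ i x → InGF2^ t x
  inGF2^-∣ {i = i} (divides k P.refl) = inGF2^-* i k

  **[2^n∸1]≈1#⇒inGF2^ : ∀ {x} n → x ** (2 ^ℕ n ∸ 1) ≈ 1# → InGF2^ n x
  **[2^n∸1]≈1#⇒inGF2^ {x} n x^[2^n-1]≈1 = begin
    x ** (2 ^ℕ n)             ≡⟨ P.cong (x **_) (1≤⇒≡suc[∸1] (ℕP.m^n>0 2 n)) ⟩
    x * x ** (2 ^ℕ n ∸ 1)     ≈⟨ *-congˡ x^[2^n-1]≈1 ⟩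
    x * 1#                    ≈⟨ *-identityʳ x ⟩
    x                         ∎

  ·-cong : ∀ n {x y} → x ≈ y → n · x ≈ n · y
  ·-cong zero p = ≈-refl
  ·-cong (suc n) p = +-cong p (·-cong n p)

  ·-homo-+ : ∀ m n x → (m +ℕ n) · x ≈ m · x + n · x
  ·-homo-+ zero n x = ≈-sym (+-identityˡ _)
  ·-homo-+ (suc m) n x = ≈-trans (+-congˡ (·-homo-+ m n x)) (≈-sym (+-assoc _ _ _))

  ·-*ʳ : ∀ n x y → n · (x * y) ≈ x * (n · y)
  ·-*ʳ zero x y = ≈-sym (zeroʳ x)
  ·-*ʳ (suc n) x y = ≈-trans (+-congˡ (·-*ʳ n x y)) (≈-sym (distribˡ x y (n · y)))

  ·-*ˡ : ∀ n x y → n · (x * y) ≈ (n · x) * y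
  ·-*ˡ zero x y = ≈-sym (zeroˡ y)
  ·-*ˡ (suc n) x y = ≈-trans (+-congˡ (·-*ˡ n x y)) (≈-sym (distribʳ y x (n · x)))

  ·-≈0 : ∀ n {x} → x ≈ 0# → n · x ≈ 0#
  ·-≈0 zero p = ≈-refl
  ·-≈0 (suc n) p = ≈0+≈0 p (·-≈0 n p)

  1·x≈x : ∀ x → 1 · x ≈ x
  1·x≈x x = +-identityʳ x

  0·x≈0 : ∀ {n} x → n ≡ 0 → n · x ≈ 0#
  0·x≈0 x P.refl = ≈-refl

  sum : ℕ → (ℕ → F) → F
  sum zero f = f 0
  sum (suc n) f = sum n f + f (suc n)

  sum-cong : ∀ n {f g : ℕ → F} → (∀ i → i ≤ℕ n → f i ≈ g i) → sum n f ≈ sum n g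
  sum-cong zero p = p 0 z≤n
  sum-cong (suc n) p = +-cong (sum-cong n (λ i i≤n → p i (ℕP.m≤n⇒m≤1+n i≤n))) (p (suc n) ℕP.≤-refl)

  sum-+ : ∀ n (f g : ℕ → F) → sum n (λ i → f i + g i) ≈ sum n f + sum n g
  sum-+ zero f g = ≈-refl
  sum-+ (suc n) f g = ≈-trans (+-congʳ (sum-+ n f g))
    (solve 4 (λ a b c d → ((a ⊕ b) ⊕ (c ⊕ d)) ⊜ ((a ⊕ c) ⊕ (b ⊕ d))) ≈-refl _ _ _ _)

  sum-*ˡ : ∀ n x (f : ℕ → F) → sum n (λ i → x * f i) ≈ x * sum n f
  sum-*ˡ zero x f = ≈-refl
  sum-*ˡ (suc n) x f = ≈-trans (+-congʳ (sum-*ˡ n x f)) (≈-sym (distribˡ x _ _))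

  sum-≈0 : ∀ n {f : ℕ → F} → (∀ i → i ≤ℕ n → f i ≈ 0#) → sum n f ≈ 0#
  sum-≈0 zero p = p 0 z≤n
  sum-≈0 (suc n) p = ≈0+≈0 (sum-≈0 n (λ i i≤n → p i (ℕP.m≤n⇒m≤1+n i≤n))) (p (suc n) ℕP.≤-refl)

  sum-single : ∀ n j {f : ℕ → F} → j ≤ℕ n → (∀ i → i ≤ℕ n → i ≢ j → f i ≈ 0#) → sum n f ≈ f j
  sum-single zero zero z≤n p = ≈-refl
  sum-single (suc n) j j≤1+n p with j ℕP.≟ suc n
  ... | yes P.refl =
    +-≈0ˡ (sum-≈0 n (λ i i≤n → p i (ℕP.m≤n⇒m≤1+n i≤n) (λ { P.refl → ℕP.<-irrefl P.refl (s≤s i≤n) }))) _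
  ... | no j≢1+n =
    ≈-trans (+-≈0ʳ _ (p (suc n) ℕP.≤-refl (λ e → j≢1+n (P.sym e))))
            (sum-single n j (ℕP.≤-pred (ℕP.≤∧≢⇒< j≤1+n j≢1+n)) (λ i i≤n → p i (ℕP.m≤n⇒m≤1+n i≤n)))

  sum-suc : ∀ n (f : ℕ → F) → sum (suc n) f ≈ f 0 + sum n (λ i → f (suc i))
  sum-suc zero f = ≈-refl
  sum-suc (suc n) f = ≈-trans (+-congʳ (sum-suc n f)) (+-assoc _ _ _)

  conv : (ℕ → F) → (ℕ → F) → ℕ → F
  conv α β n = sum n (λ i → α i * β (n ∸ i))

  conv-cong : ∀ {α α' β β' : ℕ → F} → (∀ i → α i ≈ α' i) → (∀ i → β i ≈ β' i) →
              ∀ n → conv α β n ≈ conv α' β' n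
  conv-cong p q n = sum-cong n (λ i _ → *-cong (p i) (q (n ∸ i)))

  conv-+ˡ : ∀ (α α' β : ℕ → F) n → conv (λ i → α i + α' i) β n ≈ conv α β n + conv α' β n
  conv-+ˡ α α' β n = ≈-trans (sum-cong n (λ i _ → distribʳ _ _ _)) (sum-+ n _ _)

  conv-+ʳ : ∀ (α β β' : ℕ → F) n → conv α (λ i → β i + β' i) n ≈ conv α β n + conv α β' n
  conv-+ʳ α β β' n = ≈-trans (sum-cong n (λ i _ → distribˡ _ _ _)) (sum-+ n _ _)

  conv-*ˡ : ∀ x (α β : ℕ → F) n → conv (λ i → x * α i) β n ≈ x * conv α β n
  conv-*ˡ x α β n = ≈-trans (sum-cong n (λ i _ → *-assoc _ _ _)) (sum-*ˡ n x _)

  conv-*ʳ : ∀ x (α β : ℕ → F) n → conv α (λ i → x * β i) n ≈ x * conv α β n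
  conv-*ʳ x α β n = ≈-trans (sum-cong n (λ i _ → solve 3 (λ a x b → (a ⊗ (x ⊗ b)) ⊜ (x ⊗ (a ⊗ b))) ≈-refl _ x _))
                            (sum-*ˡ n x _)

  conv-≈0ˡ : ∀ {α : ℕ → F} (β : ℕ → F) → (∀ i → α i ≈ 0#) → ∀ n → conv α β n ≈ 0#
  conv-≈0ˡ β p n = sum-≈0 n (λ i _ → *-≈0ˡ (p i) _)

  conv-≈0ʳ : ∀ (α : ℕ → F) {β : ℕ → F} → (∀ i → β i ≈ 0#) → ∀ n → conv α β n ≈ 0#
  conv-≈0ʳ α p n = sum-≈0 n (λ i _ → *-≈0ʳ _ (p _))

  shift : (ℕ → F) → ℕ → F
  shift α zero = 0#
  shift α (suc j) = α j

  conv-shiftˡ : ∀ (α β : ℕ → F) n → conv (shift α) β n ≈ shift (conv α β) n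
  conv-shiftˡ α β zero = zeroˡ _
  conv-shiftˡ α β (suc n) = ≈-trans (sum-suc n _) (+-≈0ˡ (zeroˡ _) _)

  private
    ∸-<-by-+ : ∀ {n i q} → i ≤ℕ n → n <ℕ i +ℕ q → n ∸ i <ℕ q
    ∸-<-by-+ {n} {zero} z≤n lt = lt
    ∸-<-by-+ {suc n} {suc i} (s≤s i≤n) (s≤s lt) = ∸-<-by-+ i≤n lt

  conv-leading : ∀ {α β : ℕ → F} p q → (∀ i → i <ℕ p → α i ≈ 0#) → (∀ i → i <ℕ q → β i ≈ 0#) →
                 conv α β (p +ℕ q) ≈ α p * β q
  conv-leading {α} {β} p q α-low β-low =
    ≈-trans (sum-single (p +ℕ q) p (ℕP.m≤m+n p q) off-p) (≈-by-≡ (λ k → α p * β k) (ℕP.m+n∸m≡n p q))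
    where
    off-p : ∀ i → i ≤ℕ p +ℕ q → i ≢ p → α i * β (p +ℕ q ∸ i) ≈ 0#
    off-p i i≤ i≢p with ℕP.<-cmp i p
    ... | tri< i<p _ _ = *-≈0ˡ (α-low i i<p) _
    ... | tri≈ _ i≡p _ = ⊥-elim (i≢p i≡p)
    ... | tri> _ _ p<i = *-≈0ʳ _ (β-low _ (∸-<-by-+ i≤ (ℕP.+-monoˡ-< q p<i)))

  conv-below : ∀ {α β : ℕ → F} p q → (∀ i → i <ℕ p → α i ≈ 0#) → (∀ i → i <ℕ q → β i ≈ 0#) →
               ∀ n → n <ℕ p +ℕ q → conv α β n ≈ 0#
  conv-below {α} {β} p q α-low β-low n n<p+q = sum-≈0 n term
    where
    term : ∀ i → i ≤ℕ n → α i * β (n ∸ i) ≈ 0#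
    term i i≤n with i ℕP.<? p
    ... | yes i<p = *-≈0ˡ (α-low i i<p) _
    ... | no i≮p = *-≈0ʳ _ (β-low _ (∸-<-by-+ i≤n (ℕP.<-≤-trans n<p+q (ℕP.+-monoˡ-≤ q (ℕP.≮⇒≥ i≮p)))))

  -- (x + u) ^ n = Σⱼ taylor x n j · u ^ j
  taylor : F → ℕ → ℕ → F
  taylor x n j = (n C j) · (x ** (n ∸ j))

  taylor-0 : ∀ x n → taylor x n 0 ≈ x ** n
  taylor-0 x n = 1·x≈x _

  taylor-1 : ∀ x n → taylor x n 1 ≈ n · (x ** (n ∸ 1))
  taylor-1 x n = ≈-by-≡ (λ k → k · (x ** (n ∸ 1))) (nC1≡n n)

  taylor-beyond : ∀ x {n j} → n <ℕ j → taylor x n j ≈ 0#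
  taylor-beyond x n<j = 0·x≈0 _ (k>n⇒nCk≡0 n<j)

  taylor-pascal : ∀ x n j → taylor x (suc n) j ≈ x * taylor x n j + shift (taylor x n) j
  taylor-pascal x n zero = begin
    1 · (x * x ** n)      ≈⟨ 1·x≈x _ ⟩
    x * x ** n            ≈⟨ *-congˡ (≈-sym (1·x≈x _)) ⟩
    x * taylor x n 0      ≈⟨ ≈-sym (+-identityʳ _) ⟩
    x * taylor x n 0 + 0# ∎
  taylor-pascal x n (suc j) = begin
    (suc n C suc j) · (x ** (n ∸ j))
      ≡⟨ P.cong (λ k → k · (x ** (n ∸ j))) (P.sym (nCk+nC[k+1]≡[n+1]C[k+1] n j)) ⟩
    (n C j +ℕ n C suc j) · (x ** (n ∸ j))     ≈⟨ ·-homo-+ (n C j) (n C suc j) (x ** (n ∸ j)) ⟩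
    taylor x n j + (n C suc j) · (x ** (n ∸ j)) ≈⟨ +-comm _ _ ⟩
    (n C suc j) · (x ** (n ∸ j)) + taylor x n j ≈⟨ +-congʳ next ⟩
    x * taylor x n (suc j) + taylor x n j     ∎
    where
    next : (n C suc j) · (x ** (n ∸ j)) ≈ x * taylor x n (suc j)
    next with suc j ℕP.≤? n
    ... | yes j<n = begin
      (n C suc j) · (x ** (n ∸ j))             ≡⟨ P.cong (λ k → (n C suc j) · (x ** k)) (ℕP.+-∸-assoc 1 j<n) ⟩
      (n C suc j) · (x * x ** (n ∸ suc j))     ≈⟨ ·-*ʳ (n C suc j) x (x ** (n ∸ suc j)) ⟩
      x * taylor x n (suc j)                   ∎
    ... | no j≮n = begin
      (n C suc j) · (x ** (n ∸ j))  ≈⟨ 0·x≈0 _ (k>n⇒nCk≡0 (ℕP.≰⇒> j≮n)) ⟩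
      0#                            ≈⟨ ≈-sym (*-≈0ʳ x (taylor-beyond x (ℕP.≰⇒> j≮n))) ⟩
      x * taylor x n (suc j)        ∎

  taylor-+ : ∀ x m n j → taylor x (m +ℕ n) j ≈ conv (taylor x m) (taylor x n) j
  taylor-+ x zero n zero = ≈-sym (≈-trans (*-congʳ (1·x≈x _)) (*-identityˡ _))
  taylor-+ x zero n (suc j) = ≈-sym (begin
    conv (taylor x 0) (taylor x n) (suc j)
      ≈⟨ sum-suc j _ ⟩
    taylor x 0 0 * taylor x n (suc j) + sum j (λ i → taylor x 0 (suc i) * _)
      ≈⟨ +-cong (≈-trans (*-congʳ (1·x≈x _)) (*-identityˡ _)) (sum-≈0 j (λ i _ → zeroˡ _)) ⟩
    taylor x n (suc j) + 0#
      ≈⟨ +-identityʳ _ ⟩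
    taylor x n (suc j) ∎)
  taylor-+ x (suc m) n j = begin
    taylor x (suc (m +ℕ n)) j
      ≈⟨ taylor-pascal x (m +ℕ n) j ⟩
    x * taylor x (m +ℕ n) j + shift (taylor x (m +ℕ n)) j
      ≈⟨ +-cong (*-congˡ (taylor-+ x m n j)) (shifted j) ⟩
    x * conv (taylor x m) (taylor x n) j + shift (conv (taylor x m) (taylor x n)) j
      ≈⟨ ≈-sym (+-cong (conv-*ˡ x (taylor x m) (taylor x n) j) (conv-shiftˡ (taylor x m) (taylor x n) j)) ⟩
    conv (λ i → x * taylor x m i) (taylor x n) j + conv (shift (taylor x m)) (taylor x n) j
      ≈⟨ ≈-sym (conv-+ˡ (λ i → x * taylor x m i) (shift (taylor x m)) (taylor x n) j) ⟩
    conv (λ i → x * taylor x m i + shift (taylor x m) i) (taylor x n) j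
      ≈⟨ conv-cong {β = taylor x n} (λ i → ≈-sym (taylor-pascal x m i)) (λ _ → ≈-refl) j ⟩
    conv (taylor x (suc m)) (taylor x n) j ∎
    where
    shifted : ∀ j → shift (taylor x (m +ℕ n)) j ≈ shift (conv (taylor x m) (taylor x n)) j
    shifted zero = ≈-refl
    shifted (suc j) = taylor-+ x m n j

  SameExponents : ℕ → ℕ → ℕ → ℕ → ℕ → ℕ → Set
  SameExponents e f g a b d = e ≡ a × f ≡ b × g ≡ d

  indicator : Monomial → ℕ → ℕ → ℕ → F
  indicator (κ , e , f , g) a b d = if (e ≡ᵇ a) ∧ (f ≡ᵇ b) ∧ (g ≡ᵇ d) then κ else 0#

  indicator-hit : ∀ κ e f g → indicator (κ , e , f , g) e f g ≡ κ
  indicator-hit κ e f g rewrite ≡ᵇ-refl e | ≡ᵇ-refl f | ≡ᵇ-refl g = P.refl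

  indicator-miss : ∀ κ {e f g a b d} → ¬ SameExponents e f g a b d → indicator (κ , e , f , g) a b d ≡ 0#
  indicator-miss κ {e} {f} {g} {a} {b} {d} different with e ≡ᵇ a in p | f ≡ᵇ b in q | g ≡ᵇ d in r
  ... | false | _     | _     = P.refl
  ... | true  | false | _     = P.refl
  ... | true  | true  | false = P.refl
  ... | true  | true  | true  = ⊥-elim (different (≡ᵇ-true⇒≡ e a p , ≡ᵇ-true⇒≡ f b q , ≡ᵇ-true⇒≡ g d r))

  indicator-transport : ∀ κ {e f g a b d e' f' g' a' b' d'} →
                        (SameExponents e f g a b d → SameExponents e' f' g' a' b' d') →
                        (SameExponents e' f' g' a' b' d' → SameExponents e f g a b d) →
                        indicator (κ , e , f , g) a b d ≡ indicator (κ , e' , f' , g') a' b' d'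
  indicator-transport κ {e} {f} {g} {a} {b} {d} {e'} {f'} {g'} to from with (e ℕP.≟ a) ×-dec (f ℕP.≟ b) ×-dec (g ℕP.≟ d)
  ... | no different = P.trans (indicator-miss κ different) (P.sym (indicator-miss κ (λ same → different (from same))))
  ... | yes (P.refl , P.refl , P.refl) with to (P.refl , P.refl , P.refl)
  ...   | P.refl , P.refl , P.refl = P.trans (indicator-hit κ e f g) (P.sym (indicator-hit κ e' f' g'))

  indicator-*ʳ : ∀ κ x e f g a b d → indicator (κ * x , e , f , g) a b d ≈ indicator (κ , e , f , g) a b d * x
  indicator-*ʳ κ x e f g a b d with (e ≡ᵇ a) ∧ (f ≡ᵇ b) ∧ (g ≡ᵇ d)
  ... | true = ≈-refl
  ... | false = ≈-sym (zeroˡ x)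

  coeff-++ : ∀ P Q a b d → coeff (P ++ Q) a b d ≈ coeff P a b d + coeff Q a b d
  coeff-++ [] Q a b d = ≈-sym (+-identityˡ _)
  coeff-++ (M ∷ P) Q a b d = ≈-trans (+-congˡ (coeff-++ P Q a b d)) (≈-sym (+-assoc _ _ _))

  coeff-*-++ : ∀ P Q Q' a b d → coeff (P *P (Q ++ Q')) a b d ≈ coeff (P *P Q) a b d + coeff (P *P Q') a b d
  coeff-*-++ [] Q Q' a b d = ≈-sym (+-identityˡ _)
  coeff-*-++ (M ∷ P) Q Q' a b d = begin
    coeff (map (mulMono M) (Q ++ Q') ++ P *P (Q ++ Q')) a b d
      ≡⟨ P.cong (λ L → coeff (L ++ P *P (Q ++ Q')) a b d) (map-++ (mulMono M) Q Q') ⟩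
    coeff ((MQ ++ MQ') ++ P *P (Q ++ Q')) a b d
      ≈⟨ ≈-trans (coeff-++ (MQ ++ MQ') _ a b d) (+-cong (coeff-++ MQ MQ' a b d) (coeff-*-++ P Q Q' a b d)) ⟩
    (coeff MQ a b d + coeff MQ' a b d) + (coeff (P *P Q) a b d + coeff (P *P Q') a b d)
      ≈⟨ solve 4 (λ u v w x → ((u ⊕ v) ⊕ (w ⊕ x)) ⊜ ((u ⊕ w) ⊕ (v ⊕ x))) ≈-refl _ _ _ _ ⟩
    (coeff MQ a b d + coeff (P *P Q) a b d) + (coeff MQ' a b d + coeff (P *P Q') a b d)
      ≈⟨ ≈-sym (+-cong (coeff-++ MQ (P *P Q) a b d) (coeff-++ MQ' (P *P Q') a b d)) ⟩
    coeff (MQ ++ P *P Q) a b d + coeff (MQ' ++ P *P Q') a b d ∎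
    where
    MQ = map (mulMono M) Q
    MQ' = map (mulMono M) Q'

  coeff-*-monomial : ∀ P κ e' f' g' {a b d a' b' d'} → a' ≡ a +ℕ e' → b' ≡ b +ℕ f' → d' ≡ d +ℕ g' →
                     coeff (P *P ((κ , e' , f' , g') ∷ [])) a' b' d' ≈ coeff P a b d * κ
  coeff-*-monomial [] κ e' f' g' _ _ _ = ≈-sym (zeroˡ κ)
  coeff-*-monomial ((κ₀ , e , f , g) ∷ P) κ e' f' g' {a} {b} {d} P.refl P.refl P.refl = begin
    indicator (κ₀ * κ , e +ℕ e' , f +ℕ f' , g +ℕ g') (a +ℕ e') (b +ℕ f') (d +ℕ g') + rest
      ≡⟨ P.cong (_+ rest) (indicator-transport (κ₀ * κ) cancel (λ { (P.refl , P.refl , P.refl) → P.refl , P.refl , P.refl })) ⟩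
    indicator (κ₀ * κ , e , f , g) a b d + rest
      ≈⟨ +-cong (indicator-*ʳ κ₀ κ e f g a b d) (coeff-*-monomial P κ e' f' g' P.refl P.refl P.refl) ⟩
    indicator (κ₀ , e , f , g) a b d * κ + coeff P a b d * κ
      ≈⟨ ≈-sym (distribʳ κ _ _) ⟩
    coeff ((κ₀ , e , f , g) ∷ P) a b d * κ ∎
    where
    rest = coeff (P *P ((κ , e' , f' , g') ∷ [])) (a +ℕ e') (b +ℕ f') (d +ℕ g')
    cancel : SameExponents (e +ℕ e') (f +ℕ f') (g +ℕ g') (a +ℕ e') (b +ℕ f') (d +ℕ g') → SameExponents e f g a b d
    cancel (p , q , r) = ℕP.+-cancelʳ-≡ e' e a p , ℕP.+-cancelʳ-≡ f' f b q , ℕP.+-cancelʳ-≡ g' g d r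

  coeff-*-monomial-lowʸ : ∀ P κ e' f' g' {a b d} → b <ℕ f' → coeff (P *P ((κ , e' , f' , g') ∷ [])) a b d ≈ 0#
  coeff-*-monomial-lowʸ [] κ e' f' g' b<f' = ≈-refl
  coeff-*-monomial-lowʸ ((κ₀ , e , f , g) ∷ P) κ e' f' g' {a} {b} {d} b<f' =
    ≈0+≈0 (reflexive (indicator-miss (κ₀ * κ) {e +ℕ e'} {f +ℕ f'} {g +ℕ g'} {a} {b} {d} different))
          (coeff-*-monomial-lowʸ P κ e' f' g' b<f')
    where
    different : ¬ SameExponents (e +ℕ e') (f +ℕ f') (g +ℕ g') a b d
    different (_ , f+f'≡b , _) = ℕP.<⇒≱ b<f' (P.subst (f' ≤ℕ_) f+f'≡b (ℕP.m≤n+m f' f))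

  Weight : Set c
  Weight = ℕ → ℕ → ℕ → F

  linear : Weight → Poly3 → F
  linear w [] = 0#
  linear w ((κ , e , f , g) ∷ P) = κ * w e f g + linear w P

  linear-++ : ∀ w P Q → linear w (P ++ Q) ≈ linear w P + linear w Q
  linear-++ w [] Q = ≈-sym (+-identityˡ _)
  linear-++ w ((κ , e , f , g) ∷ P) Q = ≈-trans (+-congˡ (linear-++ w P Q)) (≈-sym (+-assoc _ _ _))

  linear-congʷ : ∀ {w w' : Weight} P → (∀ e f g → w e f g ≈ w' e f g) → linear w P ≈ linear w' P
  linear-congʷ [] w≈w' = ≈-refl
  linear-congʷ ((κ , e , f , g) ∷ P) w≈w' = +-cong (*-congˡ (w≈w' e f g)) (linear-congʷ P w≈w')

  linear-+ʷ : ∀ (w w' : Weight) P → linear (λ e f g → w e f g + w' e f g) P ≈ linear w P + linear w' P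
  linear-+ʷ w w' [] = ≈-sym (+-identityˡ _)
  linear-+ʷ w w' ((κ , e , f , g) ∷ P) = ≈-trans (+-cong (distribˡ _ _ _) (linear-+ʷ w w' P))
    (solve 4 (λ a b c d → ((a ⊕ b) ⊕ (c ⊕ d)) ⊜ ((a ⊕ c) ⊕ (b ⊕ d))) ≈-refl _ _ _ _)

  linear-*ʷ : ∀ x (w : Weight) P → linear (λ e f g → x * w e f g) P ≈ x * linear w P
  linear-*ʷ x w [] = ≈-sym (zeroʳ x)
  linear-*ʷ x w ((κ , e , f , g) ∷ P) =
    ≈-trans (+-cong (solve 3 (λ k x y → (k ⊗ (x ⊗ y)) ⊜ (x ⊗ (k ⊗ y))) ≈-refl κ x _) (linear-*ʷ x w P))
            (≈-sym (distribˡ x _ _))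

  linear-0ʷ : ∀ P → linear (λ _ _ _ → 0#) P ≈ 0#
  linear-0ʷ [] = ≈-refl
  linear-0ʷ ((κ , e , f , g) ∷ P) = ≈0+≈0 (zeroʳ κ) (linear-0ʷ P)

  exponentBound : Poly3 → ℕ
  exponentBound [] = 0
  exponentBound ((κ , e , f , g) ∷ P) = e +ℕ (f +ℕ (g +ℕ exponentBound P))

  coeff-beyond-bound : ∀ P {e} f g → exponentBound P <ℕ e → coeff P e f g ≈ 0#
  coeff-beyond-bound [] f g _ = ≈-refl
  coeff-beyond-bound ((κ , e₀ , f₀ , g₀) ∷ P) {e} f g bound<e =
    ≈0+≈0 (reflexive (indicator-miss κ {e₀} {f₀} {g₀} {e} {f} {g} (λ (e₀≡e , _) → ℕP.<⇒≱ bound<e (P.subst (_≤ℕ _) e₀≡e e₀≤))))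
          (coeff-beyond-bound P f g (ℕP.≤-<-trans P≤ bound<e))
    where
    e₀≤ = proj₁ (+-≤-split e₀ ℕP.≤-refl)
    P≤ = proj₂ (+-≤-split g₀ (proj₂ (+-≤-split f₀ (proj₂ (+-≤-split e₀ ℕP.≤-refl)))))

  boxSum : Poly3 → ℕ → Weight → F
  boxSum P N w = sum N (λ e → sum N (λ f → sum N (λ g → coeff P e f g * w e f g)))

  linear≈boxSum : ∀ P N w → exponentBound P ≤ℕ N → linear w P ≈ boxSum P N w
  linear≈boxSum [] N w _ = ≈-sym (sum-≈0 N (λ e _ → sum-≈0 N (λ f _ → sum-≈0 N (λ g _ → zeroˡ _))))
  linear≈boxSum ((κ , e₀ , f₀ , g₀) ∷ P) N w bound≤N = begin
    κ * w e₀ f₀ g₀ + linear w P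
      ≈⟨ +-cong (≈-sym head) (linear≈boxSum P N w P≤N) ⟩
    sum N (λ e → sum N (λ f → sum N (λ g → I e f g * w e f g))) + boxSum P N w
      ≈⟨ ≈-sym (sum-+ N _ _) ⟩
    sum N (λ e → sum N (λ f → sum N (λ g → I e f g * w e f g)) + sum N (λ f → sum N (λ g → coeff P e f g * w e f g)))
      ≈⟨ sum-cong N (λ e _ → ≈-sym (sum-+ N _ _)) ⟩
    sum N (λ e → sum N (λ f → sum N (λ g → I e f g * w e f g) + sum N (λ g → coeff P e f g * w e f g)))
      ≈⟨ sum-cong N (λ e _ → sum-cong N (λ f _ → ≈-sym (sum-+ N _ _))) ⟩
    sum N (λ e → sum N (λ f → sum N (λ g → I e f g * w e f g + coeff P e f g * w e f g)))
      ≈⟨ sum-cong N (λ e _ → sum-cong N (λ f _ → sum-cong N (λ g _ → ≈-sym (distribʳ _ _ _)))) ⟩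
    boxSum ((κ , e₀ , f₀ , g₀) ∷ P) N w ∎
    where
    I = indicator (κ , e₀ , f₀ , g₀)
    e₀≤N = proj₁ (+-≤-split e₀ bound≤N)
    f₀≤N = proj₁ (+-≤-split f₀ (proj₂ (+-≤-split e₀ bound≤N)))
    g₀≤N = proj₁ (+-≤-split g₀ (proj₂ (+-≤-split f₀ (proj₂ (+-≤-split e₀ bound≤N)))))
    P≤N = proj₂ (+-≤-split g₀ (proj₂ (+-≤-split f₀ (proj₂ (+-≤-split e₀ bound≤N)))))
    miss : ∀ {e f g} → ¬ SameExponents e₀ f₀ g₀ e f g → ∀ x → I e f g * x ≈ 0#
    miss {e} {f} {g} different = *-≈0ˡ (reflexive (indicator-miss κ {e₀} {f₀} {g₀} {e} {f} {g} different))
    head : sum N (λ e → sum N (λ f → sum N (λ g → I e f g * w e f g))) ≈ κ * w e₀ f₀ g₀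
    head = begin
      sum N (λ e → sum N (λ f → sum N (λ g → I e f g * w e f g)))
        ≈⟨ sum-single N e₀ e₀≤N (λ e _ e≢e₀ → sum-≈0 N (λ f _ → sum-≈0 N (λ g _ →
             miss (λ (e₀≡e , _) → e≢e₀ (P.sym e₀≡e)) _))) ⟩
      sum N (λ f → sum N (λ g → I e₀ f g * w e₀ f g))
        ≈⟨ sum-single N f₀ f₀≤N (λ f _ f≢f₀ → sum-≈0 N (λ g _ →
             miss (λ (_ , f₀≡f , _) → f≢f₀ (P.sym f₀≡f)) _)) ⟩
      sum N (λ g → I e₀ f₀ g * w e₀ f₀ g)
        ≈⟨ sum-single N g₀ g₀≤N (λ g _ g≢g₀ → miss (λ (_ , _ , g₀≡g) → g≢g₀ (P.sym g₀≡g)) _) ⟩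
      I e₀ f₀ g₀ * w e₀ f₀ g₀
        ≈⟨ *-congʳ (reflexive (indicator-hit κ e₀ f₀ g₀)) ⟩
      κ * w e₀ f₀ g₀ ∎

  linear-cong : ∀ {P Q} w → P ≈P Q → linear w P ≈ linear w Q
  linear-cong {P} {Q} w P≈Q = begin
    linear w P  ≈⟨ linear≈boxSum P N w (ℕP.m≤m+n _ _) ⟩
    boxSum P N w ≈⟨ sum-cong N (λ e _ → sum-cong N (λ f _ → sum-cong N (λ g _ → *-congʳ (P≈Q e f g)))) ⟩
    boxSum Q N w ≈⟨ ≈-sym (linear≈boxSum Q N w (ℕP.m≤n+m _ _)) ⟩
    linear w Q  ∎
    where N = exponentBound P +ℕ exponentBound Q

  linear-congʷ-on-support : ∀ {w w' : Weight} P → (∀ e f g → coeff P e f g ≈ 0# ⊎ w e f g ≈ w' e f g) →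
                            linear w P ≈ linear w' P
  linear-congʷ-on-support {w} {w'} P agree = begin
    linear w P    ≈⟨ linear≈boxSum P N w ℕP.≤-refl ⟩
    boxSum P N w  ≈⟨ sum-cong N (λ e _ → sum-cong N (λ f _ → sum-cong N (λ g _ → term e f g))) ⟩
    boxSum P N w' ≈⟨ ≈-sym (linear≈boxSum P N w' ℕP.≤-refl) ⟩
    linear w' P   ∎
    where
    N = exponentBound P
    term : ∀ e f g → coeff P e f g * w e f g ≈ coeff P e f g * w' e f g
    term e f g with agree e f g
    ... | inj₁ coeff≈0 = ≈-trans (*-≈0ˡ coeff≈0 _) (≈-sym (*-≈0ˡ coeff≈0 _))
    ... | inj₂ w≈w' = *-congˡ w≈w'

  localWeight : F → F → F → ℕ → ℕ → ℕ → Weight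
  localWeight a b d j k l e f g = taylor a e j * taylor b f k * taylor d g l

  localCoeff-linear : ∀ P a b d j k l → localCoeff P a b d j k l ≈ linear (localWeight a b d j k l) P
  localCoeff-linear [] a b d j k l = ≈-refl
  localCoeff-linear ((κ , e , f , g) ∷ P) a b d j k l = +-cong monomial (localCoeff-linear P a b d j k l)
    where
    A = a ** (e ∸ j)
    B = b ** (f ∸ k)
    D = d ** (g ∸ l)
    monomial : (e C j) · ((f C k) · ((g C l) · (κ * A * B * D))) ≈ κ * (taylor a e j * taylor b f k * taylor d g l)
    monomial = begin
      (e C j) · ((f C k) · ((g C l) · (κ * A * B * D)))
        ≈⟨ ·-cong (e C j) (·-cong (f C k) (·-*ʳ (g C l) (κ * A * B) D)) ⟩
      (e C j) · ((f C k) · ((κ * A * B) * taylor d g l))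
        ≈⟨ ·-cong (e C j) (·-cong (f C k)
             (CM.solve 4 (λ k a b t → (((k CM.⊕ a) CM.⊕ b) CM.⊕ t) CM.⊜ (((k CM.⊕ a) CM.⊕ t) CM.⊕ b)) ≈-refl κ A B _)) ⟩
      (e C j) · ((f C k) · ((κ * A * taylor d g l) * B))
        ≈⟨ ·-cong (e C j) (·-*ʳ (f C k) (κ * A * taylor d g l) B) ⟩
      (e C j) · ((κ * A * taylor d g l) * taylor b f k)
        ≈⟨ ·-cong (e C j)
             (CM.solve 4 (λ k a t s → (((k CM.⊕ a) CM.⊕ t) CM.⊕ s) CM.⊜ (((k CM.⊕ t) CM.⊕ s) CM.⊕ a)) ≈-refl κ A _ _) ⟩
      (e C j) · ((κ * taylor d g l * taylor b f k) * A)
        ≈⟨ ·-*ʳ (e C j) (κ * taylor d g l * taylor b f k) A ⟩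
      (κ * taylor d g l * taylor b f k) * taylor a e j
        ≈⟨ CM.solve 4 (λ k t s r → (((k CM.⊕ t) CM.⊕ s) CM.⊕ r) CM.⊜ (k CM.⊕ ((r CM.⊕ s) CM.⊕ t))) ≈-refl κ _ _ _ ⟩
      κ * (taylor a e j * taylor b f k * taylor d g l) ∎

  evalWeight : F → F → F → Weight
  evalWeight a b d e f g = a ** e * b ** f * d ** g

  eval-linear : ∀ P a b d → eval P a b d ≈ linear (evalWeight a b d) P
  eval-linear [] a b d = ≈-refl
  eval-linear ((κ , e , f , g) ∷ P) a b d =
    +-cong (CM.solve 4 (λ k x y z → (((k CM.⊕ x) CM.⊕ y) CM.⊕ z) CM.⊜ (k CM.⊕ ((x CM.⊕ y) CM.⊕ z))) ≈-refl κ _ _ _)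
           (eval-linear P a b d)

  eval-++ : ∀ P Q a b d → eval (P ++ Q) a b d ≈ eval P a b d + eval Q a b d
  eval-++ P Q a b d = begin
    eval (P ++ Q) a b d                         ≈⟨ eval-linear (P ++ Q) a b d ⟩
    linear (evalWeight a b d) (P ++ Q)          ≈⟨ linear-++ _ P Q ⟩
    linear (evalWeight a b d) P + linear (evalWeight a b d) Q
      ≈⟨ ≈-sym (+-cong (eval-linear P a b d) (eval-linear Q a b d)) ⟩
    eval P a b d + eval Q a b d                 ∎

  localCoeff-++ : ∀ P Q a b d j k l →
                  localCoeff (P ++ Q) a b d j k l ≈ localCoeff P a b d j k l + localCoeff Q a b d j k l
  localCoeff-++ P Q a b d j k l = begin
    localCoeff (P ++ Q) a b d j k l   ≈⟨ localCoeff-linear (P ++ Q) a b d j k l ⟩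
    linear w (P ++ Q)                 ≈⟨ linear-++ w P Q ⟩
    linear w P + linear w Q           ≈⟨ ≈-sym (+-cong (localCoeff-linear P a b d j k l) (localCoeff-linear Q a b d j k l)) ⟩
    localCoeff P a b d j k l + localCoeff Q a b d j k l ∎
    where w = localWeight a b d j k l

  localCoeff-000 : ∀ P a b d → localCoeff P a b d 0 0 0 ≈ eval P a b d
  localCoeff-000 P a b d = begin
    localCoeff P a b d 0 0 0           ≈⟨ localCoeff-linear P a b d 0 0 0 ⟩
    linear (localWeight a b d 0 0 0) P ≈⟨ linear-congʷ P (λ e f g → *-cong (*-cong (taylor-0 a e) (taylor-0 b f)) (taylor-0 d g)) ⟩
    linear (evalWeight a b d) P        ≈⟨ ≈-sym (eval-linear P a b d) ⟩
    eval P a b d                       ∎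

  -- For weights reading off the j-th Taylor coefficient along a line, multiplicativity on
  -- monomials is the Vandermonde identity, and it yields the Leibniz rule for products.
  Multiplicative : (ℕ → Weight) → Set ℓ
  Multiplicative w = ∀ j e f g e' f' g' →
    w j (e +ℕ e') (f +ℕ f') (g +ℕ g') ≈ conv (λ i → w i e f g) (λ i → w i e' f' g') j

  series : (ℕ → Weight) → Poly3 → ℕ → F
  series w P j = linear (w j) P

  leibniz : ∀ {w} → Multiplicative w → ∀ P Q j → series w (P *P Q) j ≈ conv (series w P) (series w Q) j
  leibniz {w} w-mult [] Q j = ≈-sym (conv-≈0ˡ (series w Q) (λ _ → ≈-refl) j)
  leibniz {w} w-mult ((κ , e , f , g) ∷ P) Q j = begin
    linear (w j) (map (mulMono (κ , e , f , g)) Q ++ P *P Q)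
      ≈⟨ linear-++ (w j) (map (mulMono (κ , e , f , g)) Q) (P *P Q) ⟩
    linear (w j) (map (mulMono (κ , e , f , g)) Q) + linear (w j) (P *P Q)
      ≈⟨ +-cong (monomial-times Q j) (leibniz w-mult P Q j) ⟩
    conv (λ i → κ * w i e f g) (series w Q) j + conv (series w P) (series w Q) j
      ≈⟨ ≈-sym (conv-+ˡ (λ i → κ * w i e f g) (series w P) (series w Q) j) ⟩
    conv (series w ((κ , e , f , g) ∷ P)) (series w Q) j ∎
    where
    monomial-times : ∀ Q j → linear (w j) (map (mulMono (κ , e , f , g)) Q) ≈ conv (λ i → κ * w i e f g) (series w Q) j
    monomial-times [] j = ≈-sym (conv-≈0ʳ (λ i → κ * w i e f g) (λ _ → ≈-refl) j)
    monomial-times ((κ' , e' , f' , g') ∷ Q) j = begin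
      (κ * κ') * w j (e +ℕ e') (f +ℕ f') (g +ℕ g') + linear (w j) (map (mulMono (κ , e , f , g)) Q)
        ≈⟨ +-cong (*-congˡ (w-mult j e f g e' f' g')) (monomial-times Q j) ⟩
      (κ * κ') * conv (λ i → w i e f g) (λ i → w i e' f' g') j + conv (λ i → κ * w i e f g) (series w Q) j
        ≈⟨ +-congʳ scalars ⟩
      conv (λ i → κ * w i e f g) (λ i → κ' * w i e' f' g') j + conv (λ i → κ * w i e f g) (series w Q) j
        ≈⟨ ≈-sym (conv-+ʳ (λ i → κ * w i e f g) (λ i → κ' * w i e' f' g') (series w Q) j) ⟩
      conv (λ i → κ * w i e f g) (series w ((κ' , e' , f' , g') ∷ Q)) j ∎
      where
      scalars : (κ * κ') * conv (λ i → w i e f g) (λ i → w i e' f' g') j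
                ≈ conv (λ i → κ * w i e f g) (λ i → κ' * w i e' f' g') j
      scalars = ≈-sym (≈-trans (conv-*ˡ κ (λ i → w i e f g) (λ i → κ' * w i e' f' g') j)
                  (≈-trans (*-congˡ (conv-*ʳ κ' (λ i → w i e f g) (λ i → w i e' f' g') j)) (≈-sym (*-assoc _ _ _))))

  yDirection : F → F → F → ℕ → Weight
  yDirection a b d j = localWeight a b d 0 j 0

  xDirection : F → F → F → ℕ → Weight
  xDirection a b d j = localWeight a b d j 0 0

  taylor-0-+ : ∀ x m n → taylor x (m +ℕ n) 0 ≈ taylor x m 0 * taylor x n 0
  taylor-0-+ x m n = ≈-trans (taylor-0 x (m +ℕ n)) (≈-trans (**-distribˡ-+-* x m n) (≈-sym (*-cong (taylor-0 x m) (taylor-0 x n))))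

  yDirection-multiplicative : ∀ a b d → Multiplicative (yDirection a b d)
  yDirection-multiplicative a b d j e f g e' f' g' = begin
    taylor a (e +ℕ e') 0 * taylor b (f +ℕ f') j * taylor d (g +ℕ g') 0
      ≈⟨ *-cong (*-cong (taylor-0-+ a e e') (taylor-+ b f f' j)) (taylor-0-+ d g g') ⟩
    (A * A') * conv (taylor b f) (taylor b f') j * (D * D')
      ≈⟨ CM.solve 5 (λ A A' c D D' → (((A CM.⊕ A') CM.⊕ c) CM.⊕ (D CM.⊕ D'))
                                     CM.⊜ ((A CM.⊕ D) CM.⊕ ((A' CM.⊕ D') CM.⊕ c)))
                    ≈-refl A A' (conv (taylor b f) (taylor b f') j) D D' ⟩
    (A * D) * ((A' * D') * conv (taylor b f) (taylor b f') j)
      ≈⟨ ≈-sym (≈-trans (conv-*ˡ (A * D) (taylor b f) (λ i → (A' * D') * taylor b f' i) j)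
                        (*-congˡ (conv-*ʳ (A' * D') (taylor b f) (taylor b f') j))) ⟩
    conv (λ i → (A * D) * taylor b f i) (λ i → (A' * D') * taylor b f' i) j
      ≈⟨ conv-cong (λ i → reorder A D (taylor b f i)) (λ i → reorder A' D' (taylor b f' i)) j ⟩
    conv (λ i → yDirection a b d i e f g) (λ i → yDirection a b d i e' f' g') j ∎
    where
    A = taylor a e 0
    A' = taylor a e' 0
    D = taylor d g 0
    D' = taylor d g' 0
    reorder : ∀ u v t → (u * v) * t ≈ u * t * v
    reorder = CM.solve 3 (λ u v t → ((u CM.⊕ v) CM.⊕ t) CM.⊜ ((u CM.⊕ t) CM.⊕ v)) ≈-refl

  xDirection-multiplicative : ∀ a b d → Multiplicative (xDirection a b d)
  xDirection-multiplicative a b d j e f g e' f' g' = begin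
    taylor a (e +ℕ e') j * taylor b (f +ℕ f') 0 * taylor d (g +ℕ g') 0
      ≈⟨ *-cong (*-cong (taylor-+ a e e' j) (taylor-0-+ b f f')) (taylor-0-+ d g g') ⟩
    conv (taylor a e) (taylor a e') j * (B * B') * (D * D')
      ≈⟨ CM.solve 5 (λ c B B' D D' → ((c CM.⊕ (B CM.⊕ B')) CM.⊕ (D CM.⊕ D'))
                                     CM.⊜ ((B CM.⊕ D) CM.⊕ ((B' CM.⊕ D') CM.⊕ c)))
                    ≈-refl (conv (taylor a e) (taylor a e') j) B B' D D' ⟩
    (B * D) * ((B' * D') * conv (taylor a e) (taylor a e') j)
      ≈⟨ ≈-sym (≈-trans (conv-*ˡ (B * D) (taylor a e) (λ i → (B' * D') * taylor a e' i) j)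
                        (*-congˡ (conv-*ʳ (B' * D') (taylor a e) (taylor a e') j))) ⟩
    conv (λ i → (B * D) * taylor a e i) (λ i → (B' * D') * taylor a e' i) j
      ≈⟨ conv-cong (λ i → reorder B D (taylor a e i)) (λ i → reorder B' D' (taylor a e' i)) j ⟩
    conv (λ i → xDirection a b d i e f g) (λ i → xDirection a b d i e' f' g') j ∎
    where
    B = taylor b f 0
    B' = taylor b f' 0
    D = taylor d g 0
    D' = taylor d g' 0
    reorder : ∀ u v t → (u * v) * t ≈ t * u * v
    reorder = CM.solve 3 (λ u v t → ((u CM.⊕ v) CM.⊕ t) CM.⊜ ((t CM.⊕ u) CM.⊕ v)) ≈-refl

  X^n≡ : ∀ n → X ^P n ≡ (1# ** n , n , 0 , 0) ∷ []
  X^n≡ zero = P.refl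
  X^n≡ (suc n) rewrite X^n≡ n = P.refl

  Y^n≡ : ∀ n → Y ^P n ≡ (1# ** n , 0 , n , 0) ∷ []
  Y^n≡ zero = P.refl
  Y^n≡ (suc n) rewrite Y^n≡ n = P.refl

  Z^n≡ : ∀ n → Z ^P n ≡ (1# ** n , 0 , 0 , n) ∷ []
  Z^n≡ zero = P.refl
  Z^n≡ (suc n) rewrite Z^n≡ n = P.refl

  BinaryForm : ℕ → Poly3 → Set ℓ
  BinaryForm n P = ∀ e f g → ¬ InDegree n e f g → coeff P e f g ≈ 0#

  BinaryMonomials : ℕ → Poly3 → Set c
  BinaryMonomials n P = All (λ (_ , e , f , g) → InDegree n e f g) P

  binaryMonomials-++ : ∀ {n P Q} → BinaryMonomials n P → BinaryMonomials n Q → BinaryMonomials n (P ++ Q)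
  binaryMonomials-++ [] hQ = hQ
  binaryMonomials-++ (hM ∷ hP) hQ = hM ∷ binaryMonomials-++ hP hQ

  binaryMonomials-* : ∀ {m n P Q} → BinaryMonomials m P → BinaryMonomials n Q → BinaryMonomials (m +ℕ n) (P *P Q)
  binaryMonomials-* [] hQ = []
  binaryMonomials-* {P = M ∷ P} (hM ∷ hP) hQ = binaryMonomials-++ (times M hM hQ) (binaryMonomials-* hP hQ)
    where
    interchange : ∀ e e' f f' → (e +ℕ e') +ℕ (f +ℕ f') ≡ (e +ℕ f) +ℕ (e' +ℕ f')
    interchange = solve-∀
    times : ∀ {m n} M {Q} → InDegree m (proj₁ (proj₂ M)) (proj₁ (proj₂ (proj₂ M))) (proj₂ (proj₂ (proj₂ M))) →
            BinaryMonomials n Q → BinaryMonomials (m +ℕ n) (map (mulMono M) Q)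
    times M _ [] = []
    times (κ , e , f , g) {(κ' , e' , f' , g') ∷ Q} (P.refl , P.refl) ((P.refl , P.refl) ∷ hQ) =
      (P.refl , interchange e e' f f') ∷ times (κ , e , f , g) (P.refl , P.refl) hQ

  binaryMonomials-^ : ∀ {n P} → BinaryMonomials n P → ∀ k → BinaryMonomials (k *ℕ n) (P ^P k)
  binaryMonomials-^ hP zero = (P.refl , P.refl) ∷ []
  binaryMonomials-^ hP (suc k) = binaryMonomials-* hP (binaryMonomials-^ hP k)

  binaryMonomials⇒binaryForm : ∀ {n P} → BinaryMonomials n P → BinaryForm n P
  binaryMonomials⇒binaryForm [] e f g off = ≈-refl
  binaryMonomials⇒binaryForm {n} {(κ , e₀ , f₀ , g₀) ∷ P} (inDegree ∷ hP) e f g off =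
    ≈0+≈0 (reflexive (indicator-miss κ {e₀} {f₀} {g₀} {e} {f} {g} λ { (P.refl , P.refl , P.refl) → off inDegree }))
          (binaryMonomials⇒binaryForm hP e f g off)

  private
    *-1#** : ∀ x n → x * 1# ** n ≈ x
    *-1#** x n = ≈-trans (*-congˡ (1#**n≈1# n)) (*-identityʳ x)

  coeff-*-xʳ+yʳ : ∀ P r e f g →
                  coeff (P *P (X ^P r +P Y ^P r)) (e +ℕ r) (f +ℕ r) g ≈ coeff P e (f +ℕ r) g + coeff P (e +ℕ r) f g
  coeff-*-xʳ+yʳ P r e f g rewrite X^n≡ r | Y^n≡ r = begin
    coeff (P *P ((1# ** r , r , 0 , 0) ∷ (1# ** r , 0 , r , 0) ∷ [])) (e +ℕ r) (f +ℕ r) g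
      ≈⟨ coeff-*-++ P ((1# ** r , r , 0 , 0) ∷ []) ((1# ** r , 0 , r , 0) ∷ []) (e +ℕ r) (f +ℕ r) g ⟩
    coeff (P *P ((1# ** r , r , 0 , 0) ∷ [])) (e +ℕ r) (f +ℕ r) g + coeff (P *P ((1# ** r , 0 , r , 0) ∷ [])) (e +ℕ r) (f +ℕ r) g
      ≈⟨ +-cong (coeff-*-monomial P _ r 0 0 P.refl (P.sym (ℕP.+-identityʳ _)) (P.sym (ℕP.+-identityʳ _)))
                (coeff-*-monomial P _ 0 r 0 (P.sym (ℕP.+-identityʳ _)) P.refl (P.sym (ℕP.+-identityʳ _))) ⟩
    coeff P e (f +ℕ r) g * 1# ** r + coeff P (e +ℕ r) f g * 1# ** r
      ≈⟨ +-cong (*-1#** _ r) (*-1#** _ r) ⟩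
    coeff P e (f +ℕ r) g + coeff P (e +ℕ r) f g ∎

  coeff-*-xʳ+yʳ-low : ∀ P r e f g → f <ℕ r → coeff (P *P (X ^P r +P Y ^P r)) (e +ℕ r) f g ≈ coeff P e f g
  coeff-*-xʳ+yʳ-low P r e f g f<r rewrite X^n≡ r | Y^n≡ r = begin
    coeff (P *P ((1# ** r , r , 0 , 0) ∷ (1# ** r , 0 , r , 0) ∷ [])) (e +ℕ r) f g
      ≈⟨ coeff-*-++ P ((1# ** r , r , 0 , 0) ∷ []) ((1# ** r , 0 , r , 0) ∷ []) (e +ℕ r) f g ⟩
    coeff (P *P ((1# ** r , r , 0 , 0) ∷ [])) (e +ℕ r) f g + coeff (P *P ((1# ** r , 0 , r , 0) ∷ [])) (e +ℕ r) f g
      ≈⟨ +-cong (coeff-*-monomial P _ r 0 0 P.refl (P.sym (ℕP.+-identityʳ _)) (P.sym (ℕP.+-identityʳ _)))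
                (coeff-*-monomial-lowʸ P _ 0 r 0 f<r) ⟩
    coeff P e f g * 1# ** r + 0#
      ≈⟨ +-≈0ʳ _ ≈-refl ⟩
    coeff P e f g * 1# ** r
      ≈⟨ *-1#** _ r ⟩
    coeff P e f g ∎

  -- Comparing coefficients of x^(e+r) y^f in Q (x^r + y^r) determines each coefficient of Q
  -- from N and a coefficient of Q with larger x-exponent, so we recurse upwards in e.
  quotient-binaryForm : ∀ Q N n r → 1 ≤ℕ r → Q *P (X ^P r +P Y ^P r) ≈P N → BinaryForm (n +ℕ r) N → BinaryForm n Q
  quotient-binaryForm Q N n r 1≤r QG≈N N-form e f g off =
    vanish (suc (exponentBound Q)) e f g (ℕP.m≤n+m (suc (exponentBound Q)) e) off
    where
    shiftˣ : ∀ e f {g} → ¬ InDegree n e f g → ¬ InDegree (n +ℕ r) (e +ℕ r) f g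
    shiftˣ e f off (g≡0 , e+r+f≡n+r) = off (g≡0 , ℕP.+-cancelʳ-≡ r _ n (P.trans (reorder e r f) e+r+f≡n+r))
      where
      reorder : ∀ e r f → (e +ℕ f) +ℕ r ≡ (e +ℕ r) +ℕ f
      reorder = solve-∀
    moveʸˣ : ∀ e f {g} → ¬ InDegree n e (f +ℕ r) g → ¬ InDegree n (e +ℕ r) f g
    moveʸˣ e f off (g≡0 , e+r+f≡n) = off (g≡0 , P.trans (reorder e r f) e+r+f≡n)
      where
      reorder : ∀ e r f → e +ℕ (f +ℕ r) ≡ (e +ℕ r) +ℕ f
      reorder = solve-∀
    vanish : ∀ k e f g → exponentBound Q <ℕ e +ℕ k → ¬ InDegree n e f g → coeff Q e f g ≈ 0#
    vanish zero e f g Q<e off = coeff-beyond-bound Q f g (P.subst (exponentBound Q <ℕ_) (ℕP.+-identityʳ e) Q<e)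
    vanish (suc k) e f g Q<e+1+k off with f ℕP.<? r
    ... | yes f<r = begin
      coeff Q e f g                                 ≈⟨ ≈-sym (coeff-*-xʳ+yʳ-low Q r e f g f<r) ⟩
      coeff (Q *P (X ^P r +P Y ^P r)) (e +ℕ r) f g  ≈⟨ QG≈N (e +ℕ r) f g ⟩
      coeff N (e +ℕ r) f g                          ≈⟨ N-form (e +ℕ r) f g (shiftˣ e f off) ⟩
      0#                                            ∎
    ... | no f≮r =
      P.subst (λ f → ¬ InDegree n e f g → coeff Q e f g ≈ 0#) (ℕP.m∸n+n≡m (ℕP.≮⇒≥ f≮r)) (vanish-shifted (f ∸ r)) off
      where
      Q<e+r+k : exponentBound Q <ℕ (e +ℕ r) +ℕ k
      Q<e+r+k = ℕP.<-≤-trans Q<e+1+k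
        (ℕP.≤-reflexive (reassoc e k) ⟨ ℕP.≤-trans ⟩ ℕP.+-monoˡ-≤ k (ℕP.+-monoʳ-≤ e 1≤r))
        where
        reassoc : ∀ e k → e +ℕ suc k ≡ (e +ℕ 1) +ℕ k
        reassoc = solve-∀
      vanish-shifted : ∀ f₁ → ¬ InDegree n e (f₁ +ℕ r) g → coeff Q e (f₁ +ℕ r) g ≈ 0#
      vanish-shifted f₁ off = begin
        coeff Q e (f₁ +ℕ r) g
          ≈⟨ ≈-sym (+-≈0ʳ _ (vanish k (e +ℕ r) f₁ g Q<e+r+k (moveʸˣ e f₁ off))) ⟩
        coeff Q e (f₁ +ℕ r) g + coeff Q (e +ℕ r) f₁ g       ≈⟨ ≈-sym (coeff-*-xʳ+yʳ Q r e f₁ g) ⟩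
        coeff (Q *P (X ^P r +P Y ^P r)) (e +ℕ r) (f₁ +ℕ r) g ≈⟨ QG≈N (e +ℕ r) (f₁ +ℕ r) g ⟩
        coeff N (e +ℕ r) (f₁ +ℕ r) g                       ≈⟨ N-form (e +ℕ r) (f₁ +ℕ r) g (shiftˣ e (f₁ +ℕ r) off) ⟩
        0#                                                 ∎

  localCoeff-z-free : ∀ {n} P → BinaryForm n P → ∀ a b d j k l → localCoeff P a b d j k (suc l) ≈ 0#
  localCoeff-z-free P form a b d j k l = begin
    localCoeff P a b d j k (suc l)            ≈⟨ localCoeff-linear P a b d j k (suc l) ⟩
    linear (localWeight a b d j k (suc l)) P  ≈⟨ linear-congʷ-on-support P z-free ⟩
    linear (λ _ _ _ → 0#) P                   ≈⟨ linear-0ʷ P ⟩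
    0#                                        ∎
    where
    z-free : ∀ e f g → coeff P e f g ≈ 0# ⊎ localWeight a b d j k (suc l) e f g ≈ 0#
    z-free e f zero = inj₂ (zeroʳ _)
    z-free e f (suc g) = inj₁ (form e f (suc g) (λ ()))

  euler-monomial : ∀ a b d e f →
    a * localWeight a b d 1 0 0 e f 0 + b * localWeight a b d 0 1 0 e f 0 ≈ (e +ℕ f) · evalWeight a b d e f 0
  euler-monomial a b d e f = begin
    a * (taylor a e 1 * taylor b f 0 * u) + b * (taylor a e 0 * taylor b f 1 * u)
      ≈⟨ +-cong (*-congˡ (*-congʳ (*-congˡ (taylor-0 b f)))) (*-congˡ (*-congʳ (*-congʳ (taylor-0 a e)))) ⟩
    a * (taylor a e 1 * B * u) + b * (A * taylor b f 1 * u)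
      ≈⟨ +-cong (CM.solve 4 (λ a t B u → (a CM.⊕ ((t CM.⊕ B) CM.⊕ u)) CM.⊜ (((a CM.⊕ t) CM.⊕ B) CM.⊕ u)) ≈-refl a _ B u)
                (CM.solve 4 (λ b A t u → (b CM.⊕ ((A CM.⊕ t) CM.⊕ u)) CM.⊜ (((b CM.⊕ t) CM.⊕ A) CM.⊕ u)) ≈-refl b A _ u) ⟩
    (a * taylor a e 1) * B * u + (b * taylor b f 1) * A * u
      ≈⟨ +-cong (*-congʳ (*-congʳ (x*taylor-1 a e))) (*-congʳ (*-congʳ (x*taylor-1 b f))) ⟩
    (e · A) * B * u + (f · B) * A * u
      ≈⟨ +-cong (*-congʳ (≈-sym (·-*ˡ e A B))) (*-congʳ (≈-trans (≈-sym (·-*ˡ f B A)) (·-cong f (*-comm B A)))) ⟩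
    (e · (A * B)) * u + (f · (A * B)) * u
      ≈⟨ ≈-sym (distribʳ u _ _) ⟩
    (e · (A * B) + f · (A * B)) * u
      ≈⟨ *-congʳ (≈-sym (·-homo-+ e f (A * B))) ⟩
    ((e +ℕ f) · (A * B)) * u
      ≈⟨ ≈-trans (≈-sym (·-*ˡ (e +ℕ f) (A * B) u)) (·-cong (e +ℕ f) (*-congˡ (1·x≈x _))) ⟩
    (e +ℕ f) · (A * B * 1#) ∎
    where
    A = a ** e
    B = b ** f
    u = taylor d 0 0
    x*taylor-1 : ∀ x n → x * taylor x n 1 ≈ n · (x ** n)
    x*taylor-1 x n = ≈-trans (*-congˡ (taylor-1 x n)) (≈-trans (≈-sym (·-*ʳ n x _)) (absorb n))
      where
      absorb : ∀ n → n · (x * x ** (n ∸ 1)) ≈ n · (x ** n)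
      absorb zero = ≈-refl
      absorb (suc n) = ≈-refl

  euler : ∀ {n} P → BinaryForm n P → ∀ a b d →
          a * localCoeff P a b d 1 0 0 + b * localCoeff P a b d 0 1 0 ≈ n · eval P a b d
  euler {n} P form a b d = begin
    a * localCoeff P a b d 1 0 0 + b * localCoeff P a b d 0 1 0
      ≈⟨ +-cong (*-congˡ (localCoeff-linear P a b d 1 0 0)) (*-congˡ (localCoeff-linear P a b d 0 1 0)) ⟩
    a * linear (localWeight a b d 1 0 0) P + b * linear (localWeight a b d 0 1 0) P
      ≈⟨ ≈-sym (≈-trans (linear-+ʷ _ _ P) (+-cong (linear-*ʷ a _ P) (linear-*ʷ b _ P))) ⟩
    linear (λ e f g → a * localWeight a b d 1 0 0 e f g + b * localWeight a b d 0 1 0 e f g) P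
      ≈⟨ linear-congʷ-on-support P on-support ⟩
    linear (λ e f g → (n · 1#) * evalWeight a b d e f g) P
      ≈⟨ linear-*ʷ (n · 1#) _ P ⟩
    (n · 1#) * linear (evalWeight a b d) P
      ≈⟨ ≈-sym (≈-trans (·≈·1#* n _) (*-congˡ (eval-linear P a b d))) ⟩
    n · eval P a b d ∎
    where
    ·≈·1#* : ∀ n x → n · x ≈ (n · 1#) * x
    ·≈·1#* n x = ≈-trans (·-cong n (≈-sym (*-identityˡ x))) (·-*ˡ n 1# x)
    on-support : ∀ e f g → coeff P e f g ≈ 0# ⊎
      a * localWeight a b d 1 0 0 e f g + b * localWeight a b d 0 1 0 e f g ≈ (n · 1#) * evalWeight a b d e f g
    on-support e f (suc g) = inj₁ (form e f (suc g) (λ ()))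
    on-support e f zero with e +ℕ f ℕP.≟ n
    ... | no e+f≢n = inj₁ (form e f zero (λ (_ , e+f≡n) → e+f≢n e+f≡n))
    ... | yes P.refl = inj₂ (≈-trans (euler-monomial a b d e f) (·≈·1#* (e +ℕ f) _))

  module CharacteristicTwoLemmas (char2 : CharacteristicTwo) where

    x+x≈0 : ∀ x → x + x ≈ 0#
    x+x≈0 x = begin
      x + x             ≈⟨ ≈-sym (+-cong (*-identityʳ x) (*-identityʳ x)) ⟩
      x * 1# + x * 1#   ≈⟨ ≈-sym (distribˡ x 1# 1#) ⟩
      x * (1# + 1#)     ≈⟨ *-≈0ʳ x char2 ⟩
      0#                ∎

    x+y≈0⇒x≈y : ∀ {x y} → x + y ≈ 0# → x ≈ y
    x+y≈0⇒x≈y {x} {y} x+y≈0 = begin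
      x            ≈⟨ ≈-sym (+-≈0ʳ x (x+x≈0 y)) ⟩
      x + (y + y)  ≈⟨ ≈-sym (+-assoc x y y) ⟩
      (x + y) + y  ≈⟨ +-≈0ˡ x+y≈0 y ⟩
      y            ∎

    x≈y⇒x+y≈0 : ∀ {x y} → x ≈ y → x + y ≈ 0#
    x≈y⇒x+y≈0 {x} {y} x≈y = ≈-trans (+-congʳ x≈y) (x+x≈0 y)

    odd·x≈x : ∀ {n} k x → n ≡ suc (k +ℕ k) → n · x ≈ x
    odd·x≈x k x P.refl = +-≈0ʳ x (≈-trans (·-homo-+ k k x) (x+x≈0 _))

  module FieldLemmas (isField : IsField) where

    1≉0 : ¬ (1# ≈ 0#)
    1≉0 = proj₁ isField

    x*y≈0⇒x≈0 : ∀ {x y} → x * y ≈ 0# → ¬ (y ≈ 0#) → x ≈ 0#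
    x*y≈0⇒x≈0 {x} {y} x*y≈0 y≉0 with proj₂ isField y y≉0
    ... | y⁻¹ , y*y⁻¹≈1 = begin
      x               ≈⟨ ≈-sym (*-identityʳ x) ⟩
      x * 1#          ≈⟨ *-congˡ (≈-sym y*y⁻¹≈1) ⟩
      x * (y * y⁻¹)   ≈⟨ ≈-sym (*-assoc x y y⁻¹) ⟩
      (x * y) * y⁻¹   ≈⟨ *-≈0ˡ x*y≈0 y⁻¹ ⟩
      0#              ∎

    *-≉0 : ∀ {x y} → ¬ (x ≈ 0#) → ¬ (y ≈ 0#) → ¬ (x * y ≈ 0#)
    *-≉0 x≉0 y≉0 x*y≈0 = x≉0 (x*y≈0⇒x≈0 x*y≈0 y≉0)

    **-≉0 : ∀ {x} n → ¬ (x ≈ 0#) → ¬ (x ** n ≈ 0#)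
    **-≉0 zero x≉0 = 1≉0
    **-≉0 (suc n) x≉0 = *-≉0 x≉0 (**-≉0 n x≉0)

    *-cancelˡ : ∀ {x y z} → ¬ (x ≈ 0#) → x * y ≈ x * z → y ≈ z
    *-cancelˡ {x} {y} {z} x≉0 xy≈xz with proj₂ isField x x≉0
    ... | x⁻¹ , x*x⁻¹≈1 = begin
      y                ≈⟨ ≈-sym (≈-trans (*-congʳ (≈-trans (*-comm x⁻¹ x) x*x⁻¹≈1)) (*-identityˡ y)) ⟩
      (x⁻¹ * x) * y    ≈⟨ *-assoc x⁻¹ x y ⟩
      x⁻¹ * (x * y)    ≈⟨ *-congˡ xy≈xz ⟩
      x⁻¹ * (x * z)    ≈⟨ ≈-sym (*-assoc x⁻¹ x z) ⟩
      (x⁻¹ * x) * z    ≈⟨ ≈-trans (*-congʳ (≈-trans (*-comm x⁻¹ x) x*x⁻¹≈1)) (*-identityˡ z) ⟩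
      z                ∎

    inGF2^⇒**[2^n∸1]≈1# : ∀ {x} n → ¬ (x ≈ 0#) → InGF2^ n x → x ** (2 ^ℕ n ∸ 1) ≈ 1#
    inGF2^⇒**[2^n∸1]≈1# {x} n x≉0 x∈ = *-cancelˡ x≉0 (begin
      x * x ** (2 ^ℕ n ∸ 1)   ≡⟨ P.cong (x **_) (P.sym (1≤⇒≡suc[∸1] (ℕP.m^n>0 2 n))) ⟩
      x ** (2 ^ℕ n)           ≈⟨ x∈ ⟩
      x                       ≈⟨ ≈-sym (*-identityʳ x) ⟩
      x * 1#                  ∎)

    Order : (ℕ → F) → ℕ → Set ℓ
    Order α p = (∀ i → i <ℕ p → α i ≈ 0#) × ¬ (α p ≈ 0#)

    order-cong : ∀ {α β : ℕ → F} {p} → (∀ i → α i ≈ β i) → Order α p → Order β p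
    order-cong α≈β (low , α≉0) =
      (λ i i<p → ≈-trans (≈-sym (α≈β i)) (low i i<p)) , (λ β≈0 → α≉0 (≈-trans (α≈β _) β≈0))

    order-0 : ∀ {α : ℕ → F} → ¬ (α 0 ≈ 0#) → Order α 0
    order-0 α≉0 = (λ _ ()) , α≉0

    order-1 : ∀ {α : ℕ → F} → α 0 ≈ 0# → ¬ (α 1 ≈ 0#) → Order α 1
    order-1 α₀≈0 α₁≉0 = (λ { zero _ → α₀≈0 ; (suc i) (s≤s ()) }) , α₁≉0

    order-*ˡ : ∀ {α : ℕ → F} {p} x → ¬ (x ≈ 0#) → Order α p → Order (λ j → x * α j) p
    order-*ˡ x x≉0 (low , α≉0) = (λ i i<p → *-≈0ʳ x (low i i<p)) , *-≉0 x≉0 α≉0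

    order-conv : ∀ {α β : ℕ → F} {p q} → Order α p → Order β q → Order (conv α β) (p +ℕ q)
    order-conv {p = p} {q} (α-low , α≉0) (β-low , β≉0) =
      conv-below p q α-low β-low , λ conv≈0 → *-≉0 α≉0 β≉0 (≈-trans (≈-sym (conv-leading p q α-low β-low)) conv≈0)

    order-quotient : ∀ {α β γ : ℕ → F} {p q} → Order β q → (∀ j → conv α β j ≈ γ j) → Order γ (p +ℕ q) → Order α p
    order-quotient {α} {β} {γ} {p} {q} (β-low , β≉0) αβ≈γ (γ-low , γ≉0) =
      low p ℕP.≤-refl ,
      λ α≈0 → γ≉0 (≈-trans (≈-sym (αβ≈γ _)) (≈-trans (conv-leading p q (low p ℕP.≤-refl) β-low) (*-≈0ˡ α≈0 _)))
      where
      low : ∀ j → j ≤ℕ p → ∀ i → i <ℕ j → α i ≈ 0#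
      low (suc j) 1+j≤p i i<1+j with ℕP.m≤n⇒m<n∨m≡n (ℕP.≤-pred i<1+j)
      ... | inj₁ i<j = low j (ℕP.<⇒≤ 1+j≤p) i i<j
      ... | inj₂ P.refl = x*y≈0⇒x≈0 (≈-trans (≈-sym (conv-leading i q (low i (ℕP.<⇒≤ 1+j≤p)) β-low))
                                   (≈-trans (αβ≈γ _) (γ-low _ (ℕP.+-monoˡ-< q 1+j≤p)))) β≉0

    order-taylor-0# : ∀ n → Order (taylor 0# n) n
    order-taylor-0# n = low , top
      where
      low : ∀ i → i <ℕ n → taylor 0# n i ≈ 0#
      low i i<n = ·-≈0 (n C i)
        (P.subst (λ k → 0# ** k ≈ 0#) (P.sym (1≤⇒≡suc[∸1] (ℕP.m<n⇒0<n∸m i<n))) (0#**suc≈0# (n ∸ i ∸ 1)))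
      top : ¬ (taylor 0# n n ≈ 0#)
      top τ≈0 = 1≉0 (≈-trans (≈-sym (1·x≈x 1#))
        (≈-trans (reflexive (P.cong₂ (λ k l → k · (0# ** l)) (P.sym (nCn≡1 n)) (P.sym (ℕP.n∸n≡0 n)))) τ≈0))

    order-taylor-deg0 : ∀ x → Order (taylor x 0) 0
    order-taylor-deg0 x = order-0 (λ τ≈0 → 1≉0 (≈-trans (≈-sym (taylor-0 x 0)) τ≈0))

    order-taylor-≉0 : ∀ {x} n → ¬ (x ≈ 0#) → Order (taylor x n) 0
    order-taylor-≉0 n x≉0 = order-0 (λ τ≈0 → **-≉0 n x≉0 (≈-trans (≈-sym (taylor-0 _ n)) τ≈0))

    order-*P : ∀ {w} → Multiplicative w → ∀ {P Q p q} → Order (series w P) p → Order (series w Q) q →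
               Order (series w (P *P Q)) (p +ℕ q)
    order-*P w-mult {P} {Q} oP oQ = order-cong (λ j → ≈-sym (leibniz w-mult P Q j)) (order-conv oP oQ)

    order-^P : ∀ {w} → Multiplicative w → Order (series w (const 1#)) 0 → ∀ {P p} → Order (series w P) p →
               ∀ n → Order (series w (P ^P n)) (n *ℕ p)
    order-^P w-mult o1 oP zero = o1
    order-^P w-mult o1 {P} oP (suc n) = order-*P w-mult {P} {P ^P n} oP (order-^P w-mult o1 {P} oP n)

  module Curve (isField : IsField) (char2 : CharacteristicTwo) (_≈?_ : Decidable _≈_)
               (i t s : ℕ) (1≤i : 1 ≤ℕ i) (1≤t : 1 ≤ℕ t) (1≤s : 1 ≤ℕ s) (i∣t : i ∣ t)
               (δ : F) (δ≉0 : ¬ (δ ≈ 0#)) (HD : Poly3) where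
    open FieldLemmas isField
    open CharacteristicTwoLemmas char2
    open Exponents i t s 1≤i 1≤t 1≤s i∣t
    open PowersOfTwo using (2^n∸1-odd)

    r T σ S : ℕ
    r = 2 ^ℕ i ∸ 1
    T = 2 ^ℕ t ∸ 1
    σ = 2 ^ℕ s ∸ 1
    S = 2 ^ℕ s

    G u N H : Poly3
    G = X ^P r +P Y ^P r
    u = X ^P T +P Y ^P T
    N = const δ *P (X *P Y) ^P σ *P u ^P S
    H = Z ^P D +P HD

    1≤r : 1 ≤ℕ r
    1≤r = P.subst (1 ≤ℕ_) (P.sym (proj₂ (2^n∸1-odd i 1≤i))) (s≤s z≤n)

    1≤T : 1 ≤ℕ T
    1≤T = P.subst (1 ≤ℕ_) (P.sym (proj₂ (2^n∸1-odd t 1≤t))) (s≤s z≤n)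

    S≡1+σ : S ≡ suc σ
    S≡1+σ = 1≤⇒≡suc[∸1] (ℕP.m^n>0 2 s)

    0<D : 0 <ℕ D
    0<D = P.subst (0 <ℕ_) (P.sym (proj₂ D-odd)) (s≤s z≤n)

    σ≤D : σ ≤ℕ D
    σ≤D = ℕP.≤-trans (ℕP.m∸n≤m S 1) 2^s≤D

    N-monomials : BinaryMonomials (D +ℕ r) N
    N-monomials = P.subst (λ n → BinaryMonomials n N) (P.trans (regroup σ S T) degree-balance)
      (binaryMonomials-* (binaryMonomials-* {0} (inDegree ∷ []) (binaryMonomials-^ (binaryMonomials-* x y) σ))
                         (binaryMonomials-^ (binaryMonomials-++ (binaryMonomials-^ x T) (binaryMonomials-^ y T)) S))
      where
      inDegree : InDegree 0 0 0 0
      inDegree = P.refl , P.refl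
      x : BinaryMonomials 1 X
      x = (P.refl , P.refl) ∷ []
      y : BinaryMonomials 1 Y
      y = (P.refl , P.refl) ∷ []
      regroup : ∀ σ S T → σ *ℕ (1 +ℕ 1) +ℕ S *ℕ (T *ℕ 1) ≡ 2 *ℕ σ +ℕ S *ℕ T
      regroup = solve-∀

    eval-Z^n : ∀ n a b → eval (Z ^P n) a b 1# ≈ 1#
    eval-Z^n n a b rewrite Z^n≡ n = begin
      1# ** n * a ** 0 * b ** 0 * 1# ** n + 0#  ≈⟨ +-identityʳ _ ⟩
      1# ** n * 1# * 1# * 1# ** n
        ≈⟨ *-cong (≈-trans (*-identityʳ _) (≈-trans (*-identityʳ _) (1#**n≈1# n))) (1#**n≈1# n) ⟩
      1# * 1#                                  ≈⟨ *-identityʳ 1# ⟩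
      1#                                       ∎

    Z^n-∂x : ∀ n a b → localCoeff (Z ^P n) a b 1# 1 0 0 ≈ 0#
    Z^n-∂x n a b rewrite Z^n≡ n = +-identityʳ 0#

    Z^n-∂y : ∀ n a b → localCoeff (Z ^P n) a b 1# 0 1 0 ≈ 0#
    Z^n-∂y n a b rewrite Z^n≡ n = ≈-trans (+-identityʳ _) (+-identityʳ 0#)

    Z^n-at-infinity : ∀ n a b j k l → l <ℕ n → localCoeff (Z ^P n) a b 0# j k l ≈ 0#
    Z^n-at-infinity n a b j k l l<n rewrite Z^n≡ n =
      ≈-trans (localCoeff-linear ((1# ** n , 0 , 0 , n) ∷ []) a b 0# j k l)
              (≈-trans (+-identityʳ _) (*-≈0ʳ _ (*-≈0ʳ _ (proj₁ (order-taylor-0# n) l l<n))))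

    module Multiplicities (HD*G≈N : HD *P G ≈P N) where

      HD-form : BinaryForm D HD
      HD-form = quotient-binaryForm HD N D r 1≤r HD*G≈N (binaryMonomials⇒binaryForm N-monomials)

      affine-points : ∀ a b → eval H a b 1# ≈ 0# → MultZ H a b 1
      affine-points a b H≈0 = constant-term , linear-term
        where
        HD≈1 : 1# ≈ eval HD a b 1#
        HD≈1 = x+y≈0⇒x≈y (≈-trans (≈-sym (+-congʳ (eval-Z^n D a b))) (≈-trans (≈-sym (eval-++ (Z ^P D) HD a b 1#)) H≈0))
        constant-term : ∀ j k → j +ℕ k <ℕ 1 → localCoeff H a b 1# j k 0 ≈ 0#
        constant-term zero zero _ = ≈-trans (localCoeff-000 H a b 1#) H≈0
        constant-term zero (suc k) (s≤s ())
        constant-term (suc j) k (s≤s ())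
        ∂HD≈0 : ∀ {j k} → localCoeff (Z ^P D) a b 1# j k 0 ≈ 0# → localCoeff H a b 1# j k 0 ≈ 0# →
                localCoeff HD a b 1# j k 0 ≈ 0#
        ∂HD≈0 {j} {k} ∂Z≈0 ∂H≈0 =
          ≈-trans (≈-sym (+-≈0ˡ ∂Z≈0 _)) (≈-trans (≈-sym (localCoeff-++ (Z ^P D) HD a b 1# j k 0)) ∂H≈0)
        linear-term : ∃[ j ] ∃[ k ] ((j +ℕ k ≡ 1) × ¬ (localCoeff H a b 1# j k 0 ≈ 0#))
        linear-term with localCoeff H a b 1# 1 0 0 ≈? 0# | localCoeff H a b 1# 0 1 0 ≈? 0#
        ... | no ∂x≉0 | _ = 1 , 0 , P.refl , ∂x≉0
        ... | yes _ | no ∂y≉0 = 0 , 1 , P.refl , ∂y≉0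
        ... | yes ∂x≈0 | yes ∂y≈0 = ⊥-elim (1≉0 (begin
          1#                  ≈⟨ HD≈1 ⟩
          eval HD a b 1#      ≈⟨ ≈-sym (odd·x≈x (proj₁ D-odd) _ (proj₂ D-odd)) ⟩
          D · eval HD a b 1#  ≈⟨ ≈-sym (euler HD HD-form a b 1#) ⟩
          a * localCoeff HD a b 1# 1 0 0 + b * localCoeff HD a b 1# 0 1 0
            ≈⟨ ≈0+≈0 (*-≈0ʳ a (∂HD≈0 (Z^n-∂x D a b) ∂x≈0)) (*-≈0ʳ b (∂HD≈0 (Z^n-∂y D a b) ∂y≈0)) ⟩
          0#                  ∎))

      multiplicity-at-[1:b:0] : ∀ b p → Order (series (yDirection 1# b 0#) HD) p → p ≤ℕ D → MultX H b 0# p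
      multiplicity-at-[1:b:0] b p (low , HD≉0) p≤D = below , p , 0 , ℕP.+-identityʳ p , leading
        where
        HD-below : ∀ j k → j +ℕ k <ℕ p → localCoeff HD 1# b 0# 0 j k ≈ 0#
        HD-below j zero j+0<p = ≈-trans (localCoeff-linear HD 1# b 0# 0 j 0) (low j (P.subst (_<ℕ p) (ℕP.+-identityʳ j) j+0<p))
        HD-below j (suc k) _ = localCoeff-z-free HD HD-form 1# b 0# 0 j k
        below : ∀ j k → j +ℕ k <ℕ p → localCoeff H 1# b 0# 0 j k ≈ 0#
        below j k j+k<p = ≈-trans (localCoeff-++ (Z ^P D) HD 1# b 0# 0 j k)
          (≈0+≈0 (Z^n-at-infinity D 1# b 0 j k (ℕP.<-≤-trans (ℕP.≤-<-trans (ℕP.m≤n+m k j) j+k<p) p≤D)) (HD-below j k j+k<p))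
        leading : ¬ (localCoeff H 1# b 0# 0 p 0 ≈ 0#)
        leading H≈0 = HD≉0 (≈-trans (≈-sym (localCoeff-linear HD 1# b 0# 0 p 0))
          (≈-trans (≈-sym (+-≈0ˡ (Z^n-at-infinity D 1# b 0 p 0 0<D) _))
                   (≈-trans (≈-sym (localCoeff-++ (Z ^P D) HD 1# b 0# 0 p 0)) H≈0)))

      multiplicity-at-[0:1:0] : ∀ p → Order (series (xDirection 0# 1# 0#) HD) p → p ≤ℕ D → MultY H 0# 0# p
      multiplicity-at-[0:1:0] p (low , HD≉0) p≤D = below , p , 0 , ℕP.+-identityʳ p , leading
        where
        HD-below : ∀ j k → j +ℕ k <ℕ p → localCoeff HD 0# 1# 0# j 0 k ≈ 0#
        HD-below j zero j+0<p = ≈-trans (localCoeff-linear HD 0# 1# 0# j 0 0) (low j (P.subst (_<ℕ p) (ℕP.+-identityʳ j) j+0<p))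
        HD-below j (suc k) _ = localCoeff-z-free HD HD-form 0# 1# 0# j 0 k
        below : ∀ j k → j +ℕ k <ℕ p → localCoeff H 0# 1# 0# j 0 k ≈ 0#
        below j k j+k<p = ≈-trans (localCoeff-++ (Z ^P D) HD 0# 1# 0# j 0 k)
          (≈0+≈0 (Z^n-at-infinity D 0# 1# j 0 k (ℕP.<-≤-trans (ℕP.≤-<-trans (ℕP.m≤n+m k j) j+k<p) p≤D)) (HD-below j k j+k<p))
        leading : ¬ (localCoeff H 0# 1# 0# p 0 0 ≈ 0#)
        leading H≈0 = HD≉0 (≈-trans (≈-sym (localCoeff-linear HD 0# 1# 0# p 0 0))
          (≈-trans (≈-sym (+-≈0ˡ (Z^n-at-infinity D 0# 1# p 0 0 0<D) _))
                   (≈-trans (≈-sym (localCoeff-++ (Z ^P D) HD 0# 1# 0# p 0 0)) H≈0)))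

      order-HD : ∀ {w} → Multiplicative w → ∀ {p q} → Order (series w G) q → Order (series w N) (p +ℕ q) → Order (series w HD) p
      order-HD {w} w-mult oG oN =
        order-quotient oG (λ j → ≈-trans (≈-sym (leibniz w-mult HD G j)) (linear-cong {HD *P G} {N} (w j) HD*G≈N)) oN

      order-N : ∀ {w} → Multiplicative w → Order (series w (const 1#)) 0 → Order (series w (const δ)) 0 →
                ∀ {px py pu} → Order (series w X) px → Order (series w Y) py → Order (series w u) pu →
                Order (series w N) (σ *ℕ (px +ℕ py) +ℕ S *ℕ pu)
      order-N w-mult o1 oδ oX oY ou =
        order-*P w-mult {const δ *P (X *P Y) ^P σ} {u ^P S}
          (order-*P w-mult {const δ} {(X *P Y) ^P σ} oδ (order-^P w-mult o1 {X *P Y} (order-*P w-mult {X} {Y} oX oY) σ))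
          (order-^P w-mult o1 {u} ou S)

      module Line[1:b:0] (b : F) where
        w : ℕ → Weight
        w = yDirection 1# b 0#

        w-mult : Multiplicative w
        w-mult = yDirection-multiplicative 1# b 0#

        series-monomial : ∀ κ e f j → series w ((κ , e , f , 0) ∷ []) j ≈ κ * taylor b f j
        series-monomial κ e f j = ≈-trans (+-identityʳ _) (*-congˡ (begin
          taylor 1# e 0 * taylor b f j * taylor 0# 0 0  ≈⟨ *-cong (*-congʳ (≈-trans (taylor-0 1# e) (1#**n≈1# e))) (1·x≈x 1#) ⟩
          1# * taylor b f j * 1#                        ≈⟨ ≈-trans (*-identityʳ _) (*-identityˡ _) ⟩
          taylor b f j                                  ∎))

        order-monomial : ∀ {p} κ e f → ¬ (κ ≈ 0#) → Order (taylor b f) p → Order (series w ((κ , e , f , 0) ∷ [])) p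
        order-monomial κ e f κ≉0 o = order-cong (λ j → ≈-sym (series-monomial κ e f j)) (order-*ˡ κ κ≉0 o)

        order-1# : Order (series w (const 1#)) 0
        order-1# = order-monomial 1# 0 0 1≉0 (order-taylor-deg0 b)

        order-δ : Order (series w (const δ)) 0
        order-δ = order-monomial δ 0 0 δ≉0 (order-taylor-deg0 b)

        order-X : Order (series w X) 0
        order-X = order-monomial 1# 1 0 1≉0 (order-taylor-deg0 b)

        order-Y : ¬ (b ≈ 0#) → Order (series w Y) 0
        order-Y b≉0 = order-monomial 1# 0 1 1≉0 (order-taylor-≉0 1 b≉0)

        order-Y-at-0# : b ≈ 0# → Order (series w Y) 1
        order-Y-at-0# b≈0 = order-monomial 1# 0 1 1≉0
          (order-1 (≈-trans (taylor-0 b 1) (≈-trans (*-identityʳ b) b≈0))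
                   (λ τ≈0 → 1≉0 (≈-trans (≈-sym (1·x≈x 1#)) τ≈0)))

        series-X^n+Y^n : ∀ n j → series w (X ^P n +P Y ^P n) j ≈ 1# ** n * taylor b 0 j + 1# ** n * taylor b n j
        series-X^n+Y^n n j rewrite X^n≡ n | Y^n≡ n =
          ≈-trans (linear-++ (w j) ((1# ** n , n , 0 , 0) ∷ []) ((1# ** n , 0 , n , 0) ∷ []))
                  (+-cong (series-monomial (1# ** n) n 0 j) (series-monomial (1# ** n) 0 n j))

        X^n+Y^n-at-0 : ∀ n → series w (X ^P n +P Y ^P n) 0 ≈ 1# + b ** n
        X^n+Y^n-at-0 n = ≈-trans (series-X^n+Y^n n 0)
          (+-cong (≈-trans (*-cong (1#**n≈1# n) (taylor-0 b 0)) (*-identityʳ _))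
                  (≈-trans (*-cong (1#**n≈1# n) (taylor-0 b n)) (*-identityˡ _)))

        X^n+Y^n-at-1 : ∀ n → series w (X ^P n +P Y ^P n) 1 ≈ n · (b ** (n ∸ 1))
        X^n+Y^n-at-1 n = ≈-trans (series-X^n+Y^n n 1)
          (+-≈0ˡ (zeroʳ _) _ ⟨ ≈-trans ⟩ ≈-trans (*-cong (1#**n≈1# n) (taylor-1 b n)) (*-identityˡ _))

        order-X^n+Y^n-0 : ∀ n → ¬ (1# + b ** n ≈ 0#) → Order (series w (X ^P n +P Y ^P n)) 0
        order-X^n+Y^n-0 n 1+bⁿ≉0 = order-0 (λ ≈0 → 1+bⁿ≉0 (≈-trans (≈-sym (X^n+Y^n-at-0 n)) ≈0))

        order-X^n+Y^n-1 : ∀ {n} → ∃[ k ] n ≡ suc (k +ℕ k) → ¬ (b ≈ 0#) → b ** n ≈ 1# → Order (series w (X ^P n +P Y ^P n)) 1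
        order-X^n+Y^n-1 {n} (k , n-odd) b≉0 bⁿ≈1 = order-1
          (≈-trans (X^n+Y^n-at-0 n) (x≈y⇒x+y≈0 (≈-sym bⁿ≈1)))
          (λ ≈0 → **-≉0 (n ∸ 1) b≉0 (≈-trans (≈-sym (odd·x≈x k _ n-odd)) (≈-trans (≈-sym (X^n+Y^n-at-1 n)) ≈0)))

        ≈0⇒1+bⁿ≉0 : b ≈ 0# → ∀ n → 1 ≤ℕ n → ¬ (1# + b ** n ≈ 0#)
        ≈0⇒1+bⁿ≉0 b≈0 (suc n) _ ≈0 = 1≉0 (≈-trans (≈-sym (+-≈0ʳ 1# (*-≈0ˡ b≈0 _))) ≈0)

        ∉GF⇒1+b^[2^n∸1]≉0 : ∀ n → ¬ InGF2^ n b → ¬ (1# + b ** (2 ^ℕ n ∸ 1) ≈ 0#)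
        ∉GF⇒1+b^[2^n∸1]≉0 n b∉ ≈0 = b∉ (**[2^n∸1]≈1#⇒inGF2^ n (≈-sym (x+y≈0⇒x≈y ≈0)))

        ∉GF⇒≉0 : ∀ n → ¬ InGF2^ n b → ¬ (b ≈ 0#)
        ∉GF⇒≉0 n b∉ b≈0 = b∉ (inGF2^-cong n (≈-sym b≈0) (inGF2^-0# n))

        order-HD-from-factors : ∀ {p q py pu} → Order (series w G) q → Order (series w Y) py → Order (series w u) pu →
                      σ *ℕ (0 +ℕ py) +ℕ S *ℕ pu ≡ p +ℕ q → Order (series w HD) p
        order-HD-from-factors oG oY ou eq = order-HD w-mult oG (P.subst (Order (series w N)) eq (order-N w-mult order-1# order-δ order-X oY ou))

      multiplicity-GF2^i : ∀ b → InGF2^ i b → MultX H b 0# σ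
      multiplicity-GF2^i b b∈ with b ≈? 0#
      ... | yes b≈0 = multiplicity-at-[1:b:0] b σ
              (order-HD-from-factors (order-X^n+Y^n-0 r (≈0⇒1+bⁿ≉0 b≈0 r 1≤r)) (order-Y-at-0# b≈0)
                                     (order-X^n+Y^n-0 T (≈0⇒1+bⁿ≉0 b≈0 T 1≤T))
                           (arithmetic σ S)) σ≤D
        where
        open Line[1:b:0] b
        arithmetic : ∀ σ S → σ *ℕ 1 +ℕ S *ℕ 0 ≡ σ +ℕ 0
        arithmetic = solve-∀
      ... | no b≉0 = multiplicity-at-[1:b:0] b σ
              (order-HD-from-factors (order-X^n+Y^n-1 (2^n∸1-odd i 1≤i) b≉0 (inGF2^⇒**[2^n∸1]≈1# i b≉0 b∈)) (order-Y b≉0)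
                           (order-X^n+Y^n-1 (2^n∸1-odd t 1≤t) b≉0 (inGF2^⇒**[2^n∸1]≈1# t b≉0 (inGF2^-∣ i∣t b∈)))
                           (P.trans (P.cong (λ k → σ *ℕ 0 +ℕ k *ℕ 1) S≡1+σ) (arithmetic σ))) σ≤D
        where
        open Line[1:b:0] b
        arithmetic : ∀ σ → σ *ℕ 0 +ℕ suc σ *ℕ 1 ≡ σ +ℕ 1
        arithmetic = solve-∀

      multiplicity-GF2^t∖GF2^i : ∀ b → InGF2^ t b → ¬ InGF2^ i b → MultX H b 0# S
      multiplicity-GF2^t∖GF2^i b b∈ b∉ = multiplicity-at-[1:b:0] b S
        (order-HD-from-factors (order-X^n+Y^n-0 r (∉GF⇒1+b^[2^n∸1]≉0 i b∉)) (order-Y b≉0)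
                     (order-X^n+Y^n-1 (2^n∸1-odd t 1≤t) b≉0 (inGF2^⇒**[2^n∸1]≈1# t b≉0 b∈)) (arithmetic σ S)) 2^s≤D
        where
        open Line[1:b:0] b
        b≉0 = ∉GF⇒≉0 i b∉
        arithmetic : ∀ σ S → σ *ℕ 0 +ℕ S *ℕ 1 ≡ S +ℕ 0
        arithmetic = solve-∀

      multiplicity-outside-GF2^t : ∀ b → ¬ InGF2^ t b → MultX H b 0# 0
      multiplicity-outside-GF2^t b b∉ = multiplicity-at-[1:b:0] b 0
        (order-HD-from-factors
          (order-X^n+Y^n-0 r (λ ≈0 → b∉ (inGF2^-∣ i∣t (**[2^n∸1]≈1#⇒inGF2^ i (≈-sym (x+y≈0⇒x≈y ≈0))))))
                     (order-Y b≉0) (order-X^n+Y^n-0 T (∉GF⇒1+b^[2^n∸1]≉0 t b∉)) (arithmetic σ S)) z≤n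
        where
        open Line[1:b:0] b
        b≉0 = ∉GF⇒≉0 t b∉
        arithmetic : ∀ σ S → σ *ℕ 0 +ℕ S *ℕ 0 ≡ 0
        arithmetic = solve-∀

      multiplicity-[0:1:0] : MultY H 0# 0# σ
      multiplicity-[0:1:0] = multiplicity-at-[0:1:0] σ
        (order-HD w-mult (order-X^n+Y^n r 1≤r)
          (P.subst (Order (series w N)) (arithmetic σ S)
            (order-N w-mult (order-monomial 1# 0 0 1≉0 (order-taylor-0# 0)) (order-monomial δ 0 0 δ≉0 (order-taylor-0# 0))
                     (order-monomial 1# 1 0 1≉0 (order-taylor-0# 1)) (order-monomial 1# 0 1 1≉0 (order-taylor-0# 0))
                     (order-X^n+Y^n T 1≤T)))) σ≤D
        where
        w : ℕ → Weight
        w = xDirection 0# 1# 0#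
        w-mult : Multiplicative w
        w-mult = xDirection-multiplicative 0# 1# 0#
        series-monomial : ∀ κ e f j → series w ((κ , e , f , 0) ∷ []) j ≈ κ * taylor 0# e j
        series-monomial κ e f j = ≈-trans (+-identityʳ _) (*-congˡ (begin
          taylor 0# e j * taylor 1# f 0 * taylor 0# 0 0  ≈⟨ *-cong (*-congˡ (≈-trans (taylor-0 1# f) (1#**n≈1# f))) (1·x≈x 1#) ⟩
          taylor 0# e j * 1# * 1#                        ≈⟨ ≈-trans (*-identityʳ _) (*-identityʳ _) ⟩
          taylor 0# e j                                  ∎))
        order-monomial : ∀ {p} κ e f → ¬ (κ ≈ 0#) → Order (taylor 0# e) p → Order (series w ((κ , e , f , 0) ∷ [])) p
        order-monomial κ e f κ≉0 o = order-cong (λ j → ≈-sym (series-monomial κ e f j)) (order-*ˡ κ κ≉0 o)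
        order-X^n+Y^n : ∀ n → 1 ≤ℕ n → Order (series w (X ^P n +P Y ^P n)) 0
        order-X^n+Y^n (suc n) _ rewrite X^n≡ (suc n) | Y^n≡ (suc n) = order-0 (λ ≈0 → 1≉0 (≈-trans (≈-sym at-0) ≈0))
          where
          κ = 1# ** suc n
          at-0 : series w ((κ , suc n , 0 , 0) ∷ (κ , 0 , suc n , 0) ∷ []) 0 ≈ 1#
          at-0 = begin
            series w ((κ , suc n , 0 , 0) ∷ (κ , 0 , suc n , 0) ∷ []) 0
              ≈⟨ linear-++ (w 0) ((κ , suc n , 0 , 0) ∷ []) ((κ , 0 , suc n , 0) ∷ []) ⟩
            series w ((κ , suc n , 0 , 0) ∷ []) 0 + series w ((κ , 0 , suc n , 0) ∷ []) 0
              ≈⟨ +-cong (series-monomial κ (suc n) 0 0) (series-monomial κ 0 (suc n) 0) ⟩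
            κ * taylor 0# (suc n) 0 + κ * taylor 0# 0 0
              ≈⟨ +-≈0ˡ (*-≈0ʳ κ (≈-trans (taylor-0 0# (suc n)) (0#**suc≈0# n))) _ ⟩
            κ * taylor 0# 0 0
              ≈⟨ *-cong (1#**n≈1# (suc n)) (taylor-0 0# 0) ⟩
            1# * 1#
              ≈⟨ *-identityˡ 1# ⟩
            1# ∎
        arithmetic : ∀ σ S → σ *ℕ (1 +ℕ 0) +ℕ S *ℕ 0 ≡ σ +ℕ 0
        arithmetic = solve-∀

open import Level using (0ℓ)
open import Data.Nat using (_+_; _^_; _≤_)

lemma3 : (R : CommutativeRing 0ℓ 0ℓ) →
         let open Over R in
         IsField → CharacteristicTwo → AlgebraicallyClosed → AlgebraicOverGF2 →
         Decidable _≈_ →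
         (m i t s : ℕ) → 1 ≤ m → 1 ≤ i → 1 ≤ t → 1 ≤ s → i ∣ t →
         (δ : F) → InGF2^ m δ → ¬ (δ ≈ 0#) →
         (HD : Poly3) →
         HD *P (X ^P (2 ^ i ∸ 1) +P Y ^P (2 ^ i ∸ 1))
           ≈P const δ *P (X *P Y) ^P (2 ^ s ∸ 1) *P (X ^P (2 ^ t ∸ 1) +P Y ^P (2 ^ t ∸ 1)) ^P (2 ^ s) →
         let D = 2 ^ (t + s) + 2 ^ s ∸ 2 ^ i ∸ 1
             H = Z ^P D +P HD
         in (∀ a b → eval H a b 1# ≈ 0# → MultZ H a b 1)
            × (∀ b → InGF2^ i b → MultX H b 0# (2 ^ s ∸ 1))
            × (∀ b → InGF2^ t b → ¬ InGF2^ i b → MultX H b 0# (2 ^ s))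
            × (∀ b → ¬ InGF2^ t b → MultX H b 0# 0)
            × MultY H 0# 0# (2 ^ s ∸ 1)
lemma3 R isField char2 _ _ _≈?_ _ i t s _ 1≤i 1≤t 1≤s i∣t δ _ δ≉0 HD HD*G≈N =
  affine-points , multiplicity-GF2^i , multiplicity-GF2^t∖GF2^i , multiplicity-outside-GF2^t , multiplicity-[0:1:0]
  where
  open Curve R isField char2 _≈?_ i t s 1≤i 1≤t 1≤s i∣t δ δ≉0 HD
  open Multiplicities HD*G≈N
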